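{- Let $[T]\in\mathcal{T}(n,m)$. Then $[T]$ is a maximal element of the poset $\mathcal{T}(n,m)$ if and only if either $T$ is a mixed star, or $T$ has no undirected edges (i.e. $m=n-1$) and whenever $T$ contains arcs $\vec{ax},\vec{bx}$ or arcs $\vec{xa},\vec{xb}$ with $a,b,x$ distinct, one of $a$ and $b$ is a leaf.
   Context: Mixed graph on $[n]$: between two distinct vertices at most one of an arc $\vec{ij}$, an undirected edge $ij$, or nothing; adjacency matrix $a_{ij}=1$ iff $\vec{ij}$ or $ij\in E$; size = number of arcs plus twice the number of undirected edges. Mixed tree / mixed star: underlying graph (directions forgotten) is a tree / a tree of diameter at most 2; a leaf is a vertex of degree 1 in the underlying tree; $\partial$ is distance in the underlying graph. Kelmans transformation $T_b^a$ (for distinct $a,b$ with no arc between them): adjacency matrix $A'$ with, for $i\notin\{a,b\}$, $a'_{ia}=\max(a_{ia},a_{ib})$, $a'_{ib}=\min(a_{ia},a_{ib})$, $a'_{ai}=\max(a_{ai},a_{bi})$, $a'_{bi}=\min(a_{ai},a_{bi})$, other entries unchanged. $\mathcal{T}(n,m)$ is the set of isomorphism classes of mixed trees of order $n$ and size $m$. A pair $(a,b)$ in a mixed tree $T$ is admissible if $a,b$ are distinct with no arc between them and either $ab$ is an undirected edge or $\partial(a,b)=2$ with middle vertex $x$ such that $ax$ is undirected, or $xb$ is undirected, or $\vec{ax},\vec{bx}$ are arcs, or $\vec{xa},\vec{xb}$ are arcs (exactly the pairs for which $T_b^a$ is again a mixed tree). The partial order on $\mathcal{T}(n,m)$ is the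 reflexive–transitive closure of $[T]\leq[T_b^a]$ over all mixed trees $T$ and admissible pairs $(a,b)$. -}

module Defs where

open import Data.Nat using (ℕ; zero; suc; _+_; _≤_)
open import Data.Bool using (Bool; true; false; _∨_; _∧_; if_then_else_)
open import Data.Fin using (Fin; zero; suc; _≟_)
open import Data.List using (List; []; _∷_; _++_; length)
open import Data.List.Relation.Unary.Linked using (Linked)
open import Data.List.Relation.Unary.Unique.Propositional using (Unique)
open import Data.Product using (Σ; ∃; _×_; _,_)
open import Data.Sum using (_⊎_)
open import Function using (_∘_)
open import Function.Bundles using (_↔_; Inverse)
open import Relation.Nullary using (¬_)
open import Relation.Nullary.Decidable using (⌊_⌋)
open import Relation.Binary.PropositionalEquality using (_≡_; _≢_)
open import Relation.Binary.Construct.Closure.ReflexiveTransitive using (Star)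

-- Mixed graphs on [n] = Fin n, given by their 0/1 adjacency matrix
-- (true = 1).  a_ij = a_ji = 1 : undirected edge ij;
-- a_ij = 1, a_ji = 0 : arc ij;  a_ij = a_ji = 0 : nothing.

Mat : ℕ → Set
Mat n = Fin n → Fin n → Bool

IsMixedGraph : ∀ {n} → Mat n → Set
IsMixedGraph {n} A = (i : Fin n) → A i i ≡ false

Σ[_] : ∀ {n} → (Fin n → ℕ) → ℕ
Σ[_] {zero}  f = 0
Σ[_] {suc n} f = f zero + Σ[ f ∘ suc ]

b2n : Bool → ℕ
b2n true  = 1
b2n false = 0

-- size = #arcs + 2 * #undirected edges = number of 1-entries
size : ∀ {n} → Mat n → ℕ
size A = Σ[ (λ i → Σ[ (λ j → b2n (A i j)) ]) ]

Arc : ∀ {n} → Mat n → Fin n → Fin n → Set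
Arc A i j = A i j ≡ true × A j i ≡ false

Undir : ∀ {n} → Mat n → Fin n → Fin n → Set
Undir A i j = A i j ≡ true × A j i ≡ true

adjB : ∀ {n} → Mat n → Fin n → Fin n → Bool
adjB A i j = A i j ∨ A j i

Adj : ∀ {n} → Mat n → Fin n → Fin n → Set
Adj A i j = adjB A i j ≡ true

deg : ∀ {n} → Mat n → Fin n → ℕ
deg A i = Σ[ (λ j → b2n (adjB A i j)) ]

Leaf : ∀ {n} → Mat n → Fin n → Set
Leaf A i = deg A i ≡ 1

Connected : ∀ {n} → Mat n → Set
Connected {n} A = (i j : Fin n) → Star (Adj A) i j

HasCycle : ∀ {n} → Mat n → Set
HasCycle {n} A =
  Σ (Fin n) λ v → Σ (List (Fin n)) λ vs →
    2 ≤ length vs × Unique (v ∷ vs) × Linked (Adj A) (v ∷ vs ++ v ∷ [])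

IsMixedTree : ∀ {n} → Mat n → Set
IsMixedTree A = IsMixedGraph A × Connected A × ¬ HasCycle A

-- mixed star: mixed tree whose underlying tree has diameter ≤ 2
IsMixedStar : ∀ {n} → Mat n → Set
IsMixedStar {n} A = IsMixedTree A ×
  ((i j : Fin n) → i ≡ j ⊎ Adj A i j ⊎ Σ (Fin n) λ x → Adj A i x × Adj A x j)

NoUndirected : ∀ {n} → Mat n → Set
NoUndirected {n} A = (i j : Fin n) → ¬ Undir A i j

_==_ : ∀ {n} → Fin n → Fin n → Bool
i == j = ⌊ i ≟ j ⌋

kelmans : ∀ {n} → Fin n → Fin n → Mat n → Mat n
kelmans a b A i j =
  if (i == a) ∨ (i == b)
  then (if (j == a) ∨ (j == b)
        then A i j
        else (if i == a then A a j ∨ A b j else A a j ∧ A b j))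
  else (if j == a then A i a ∨ A i b
        else (if j == b then A i a ∧ A i b else A i j))

Admissible : ∀ {n} → Mat n → Fin n → Fin n → Set
Admissible {n} A a b =
  a ≢ b × ¬ Arc A a b × ¬ Arc A b a ×
  (Undir A a b ⊎
   (¬ Adj A a b × Σ (Fin n) λ x → Adj A a x × Adj A x b ×
      (Undir A a x ⊎ Undir A x b ⊎ (Arc A a x × Arc A b x) ⊎ (Arc A x a × Arc A x b))))

Iso : ∀ {n} → Mat n → Mat n → Set
Iso {n} A B = Σ (Fin n ↔ Fin n) λ σ →
  (i j : Fin n) → A i j ≡ B (Inverse.to σ i) (Inverse.to σ j)

KStep : ∀ {n} → Mat n → Mat n → Set
KStep {n} A B = IsMixedTree A ×
  Σ (Fin n) λ a → Σ (Fin n) λ b → Admissible A a b × Iso B (kelmans a b A)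

-- the partial order on isomorphism classes, lifted to representatives:
-- reflexive–transitive closure of isomorphism and Kelmans steps
_≼_ : ∀ {n} → Mat n → Mat n → Set
A ≼ B = Star (λ X Y → Iso X Y ⊎ KStep X Y) A B

IsMaximal : ∀ {n} → ℕ → Mat n → Set
IsMaximal {n} m A = (B : Mat n) → IsMixedTree B → size B ≡ m → A ≼ B → Iso A B

ArcPairCond : ∀ {n} → Mat n → Set
ArcPairCond {n} A = (a b x : Fin n) → a ≢ b → a ≢ x → b ≢ x →
  ((Arc A a x × Arc A b x) ⊎ (Arc A x a × Arc A x b)) → Leaf A a ⊎ Leaf A b

{-# OPTIONS --safe #-}
module Submission where

-- If T is a mixed star, or an oriented tree in which two arcs into (or out of) a common vertex always
-- have a leaf at one end, then for every admissible pair (a , b) one of a, b dominates the other: it is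
-- joined, in the same directions, to every vertex outside {a, b} that the other is joined to. T_b^a is
-- then T itself or T with a and b exchanged, so Kelmans steps never leave the isomorphism class of T.
-- Conversely, the number of leaves is an isomorphism invariant. If T is not a star and has an
-- undirected edge, or has two arcs into (or out of) a vertex with no leaf at their ends, a Kelmans step
-- on two non-leaves a, b, preceded if necessary by a step that merely turns an arc at a pendant
-- undirected edge into an undirected edge, makes b a leaf and keeps every other vertex's leaf status:
-- a mixed tree of the same size with one more leaf, so T is not maximal.

open import Defs
open import Algebra.Bundles using (CommutativeMonoid)
import Algebra.Properties.CommutativeMonoid.Sum as MonoidSum
import Algebra.Properties.CommutativeSemigroup as SemigroupProperties
open import Data.Bool using (Bool; true; false; _∨_; _∧_; if_then_else_)
open import Data.Bool.Properties using (∨-comm; ∨-zeroʳ; ∨-identityʳ; ∧-identityʳ; ∨-commutativeMonoid)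
  renaming (_≟_ to _≟ᵇ_)
open import Data.Empty using (⊥; ⊥-elim)
open import Data.Fin using (Fin; zero; suc; _≟_)
open import Data.Fin.Permutation using () renaming (transpose to transpositionᵖ)
open import Data.Fin.Permutation.Components using (transpose)
open import Data.Fin.Properties using (suc-injective; any?; all?)
open import Data.List using (List; []; _∷_; _++_; length; [_])
open import Data.List.Membership.Propositional using (_∈_; _∉_)
open import Data.List.Membership.Propositional.Properties using (∈-++⁺ˡ; ∈-++⁺ʳ; ∈-++⁻; ∈-∃++)
import Data.List.Membership.DecPropositional as DecMembership
open import Data.List.Properties using (++-assoc; length-++-comm; ∷-injective)
open import Data.List.Relation.Binary.Disjoint.Propositional using (Disjoint)
open import Data.List.Relation.Unary.All as All using (All; []; _∷_)
open import Data.List.Relation.Unary.AllPairs using ([]; _∷_)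
open import Data.List.Relation.Unary.Any using (here; there)
open import Data.List.Relation.Unary.Linked as Linked using (Linked; []; [-]; _∷_)
open import Data.List.Relation.Unary.Unique.Propositional using (Unique)
import Data.List.Relation.Unary.Unique.Propositional.Properties as Unique
open import Data.Nat using (ℕ; zero; suc; _+_; _≤_; z≤n; s≤s) renaming (_≟_ to _≟ℕ_)
open import Data.Nat.Properties
  using (+-comm; +-assoc; +-identityʳ; +-mono-≤; m≤n+m; +-cancelʳ-≡; ≤-trans; ≤-reflexive; 1+n≢n;
         +-0-commutativeMonoid; +-commutativeSemigroup)
open import Data.Nat.Tactic.RingSolver using (solve-∀)
open import Data.Product using (Σ; _×_; _,_; proj₁; proj₂; swap)
open import Data.Sum as Sum using (_⊎_; inj₁; inj₂; [_,_]′)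
open import Function using (_∘_)
open import Function.Bundles using (_↔_; _⇔_; Inverse; mk⇔)
open import Function.Construct.Composition using (_↔-∘_)
open import Function.Construct.Identity using (↔-id)
open import Function.Construct.Symmetry using (↔-sym)
open import Relation.Binary.Construct.Closure.ReflexiveTransitive using (Star; ε; _◅_; _◅◅_; _⋆; reverse)
  renaming (map to Star-map)
open import Relation.Binary.PropositionalEquality
  using (_≡_; _≢_; refl; sym; trans; cong; cong₂; subst; module ≡-Reasoning)
open import Relation.Nullary using (¬_; yes; no; Dec)
open import Relation.Nullary.Decidable
  using (_×-dec_; _⊎-dec_; ¬?; dec-true; dec-false; toSum; decidable-stable)

open MonoidSum +-0-commutativeMonoid using (sum; sum-permute)
open SemigroupProperties (CommutativeMonoid.commutativeSemigroup ∨-commutativeMonoid) using ()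
  renaming (interchange to ∨-interchange)
open SemigroupProperties +-commutativeSemigroup using () renaming (interchange to +-interchange)

==-refl : ∀ {n} (i : Fin n) → (i == i) ≡ true
==-refl i with i ≟ i
... | yes _ = refl
... | no i≢i = ⊥-elim (i≢i refl)

==-false : ∀ {n} {i j : Fin n} → i ≢ j → (i == j) ≡ false
==-false {i = i} {j} i≢j with i ≟ j
... | yes i≡j = ⊥-elim (i≢j i≡j)
... | no _ = refl

true≢false : ∀ {x : Bool} → x ≡ true → x ≡ false → ⊥
true≢false refl ()

∨-true : ∀ {x y} → (x ∨ y) ≡ true → x ≡ true ⊎ y ≡ true
∨-true {true} _ = inj₁ refl
∨-true {false} e = inj₂ e

∧-∨-∧-true : ∀ p q r s → ((p ∧ q) ∨ (r ∧ s)) ≡ true → (p ∨ r) ≡ true × (q ∨ s) ≡ true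
∧-∨-∧-true true true r s _ = refl , refl
∧-∨-∧-true true false true true _ = refl , refl
∧-∨-∧-true false true true true _ = refl , refl
∧-∨-∧-true false false true true _ = refl , refl
∧-∨-∧-true true false true false ()
∧-∨-∧-true true false false s ()
∧-∨-∧-true false q true false ()
∧-∨-∧-true false q false s ()

∨-dominatedʳ : ∀ {p q} → (q ≡ true → p ≡ true) → (p ∨ q) ≡ p
∨-dominatedʳ {true} _ = refl
∨-dominatedʳ {false} {true} q⇒p = sym (q⇒p refl)
∨-dominatedʳ {false} {false} _ = refl

∧-dominatedʳ : ∀ {p q} → (q ≡ true → p ≡ true) → (p ∧ q) ≡ q
∧-dominatedʳ {true} _ = refl
∧-dominatedʳ {false} {true} q⇒p = q⇒p refl
∧-dominatedʳ {false} {false} _ = refl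

∨-dominatedˡ : ∀ {p q} → (p ≡ true → q ≡ true) → (p ∨ q) ≡ q
∨-dominatedˡ {true} p⇒q = sym (p⇒q refl)
∨-dominatedˡ {false} _ = refl

∧-dominatedˡ : ∀ {p q} → (p ≡ true → q ≡ true) → (p ∧ q) ≡ p
∧-dominatedˡ {true} p⇒q = p⇒q refl
∧-dominatedˡ {false} _ = refl

b2n-true : ∀ {x} → x ≡ true → b2n x ≡ 1
b2n-true refl = refl

b2n-∨+∧ : ∀ p q → b2n (p ∨ q) + b2n (p ∧ q) ≡ b2n p + b2n q
b2n-∨+∧ true true = refl
b2n-∨+∧ true false = refl
b2n-∨+∧ false true = refl
b2n-∨+∧ false false = refl

b2n-mono-∨ : ∀ p q → b2n p ≤ b2n (p ∨ q)
b2n-mono-∨ true q = s≤s z≤n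
b2n-mono-∨ false q = z≤n

Σ-cong : ∀ {n} {f g : Fin n → ℕ} → (∀ i → f i ≡ g i) → Σ[ f ] ≡ Σ[ g ]
Σ-cong {zero} _ = refl
Σ-cong {suc n} f≗g = cong₂ _+_ (f≗g zero) (Σ-cong (f≗g ∘ suc))

Σ-mono-≤ : ∀ {n} {f g : Fin n → ℕ} → (∀ i → f i ≤ g i) → Σ[ f ] ≤ Σ[ g ]
Σ-mono-≤ {zero} _ = z≤n
Σ-mono-≤ {suc n} f≤g = +-mono-≤ (f≤g zero) (Σ-mono-≤ (f≤g ∘ suc))

Σ-distrib-+ : ∀ {n} (f g : Fin n → ℕ) → Σ[ (λ j → f j + g j) ] ≡ Σ[ f ] + Σ[ g ]
Σ-distrib-+ {zero} f g = refl
Σ-distrib-+ {suc n} f g rewrite Σ-distrib-+ (f ∘ suc) (g ∘ suc) =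
  +-interchange (f zero) (g zero) Σ[ f ∘ suc ] Σ[ g ∘ suc ]

Σ-zero : ∀ {n} → Σ[ (λ (_ : Fin n) → 0) ] ≡ 0
Σ-zero {zero} = refl
Σ-zero {suc n} = Σ-zero {n}

-- Stated additively to avoid truncated subtraction.
Σ-change₁ : ∀ {n} (p : Fin n) {f g : Fin n → ℕ} → (∀ j → j ≢ p → f j ≡ g j) →
            Σ[ f ] + g p ≡ Σ[ g ] + f p
Σ-change₁ {suc n} zero {f} {g} f≗g
  rewrite Σ-cong {f = f ∘ suc} {g = g ∘ suc} (λ j → f≗g (suc j) λ ()) = swap-ends (f zero) Σ[ g ∘ suc ] (g zero)
  where
  swap-ends : ∀ x s y → x + s + y ≡ y + s + x
  swap-ends = solve-∀
Σ-change₁ {suc n} (suc p) {f} {g} f≗g rewrite f≗g zero (λ ()) =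
  begin
    g zero + Σ[ f ∘ suc ] + g (suc p)   ≡⟨ +-assoc (g zero) _ _ ⟩
    g zero + (Σ[ f ∘ suc ] + g (suc p)) ≡⟨ cong (g zero +_) (Σ-change₁ p {f ∘ suc} {g ∘ suc} f≗g′) ⟩
    g zero + (Σ[ g ∘ suc ] + f (suc p)) ≡⟨ +-assoc (g zero) _ _ ⟨
    g zero + Σ[ g ∘ suc ] + f (suc p)   ∎
  where
  open ≡-Reasoning
  f≗g′ : ∀ j → j ≢ p → f (suc j) ≡ g (suc j)
  f≗g′ j j≢p = f≗g (suc j) (j≢p ∘ suc-injective)

Σ-change₂ : ∀ {n} {p q : Fin n} {f g : Fin n → ℕ} → p ≢ q → (∀ j → j ≢ p → j ≢ q → f j ≡ g j) →
            Σ[ f ] + (g p + g q) ≡ Σ[ g ] + (f p + f q)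
Σ-change₂ {n} {p} {q} {f} {g} p≢q f≗g =
  begin
    Σ[ f ] + (g p + g q)  ≡⟨ +-assoc Σ[ f ] (g p) (g q) ⟨
    Σ[ f ] + g p + g q    ≡⟨ cong (_+ g q) (trans (cong (Σ[ f ] +_) (sym hp)) (Σ-change₁ p f≗h)) ⟩
    Σ[ h ] + f p + g q    ≡⟨ rotate Σ[ h ] (f p) (g q) ⟩
    Σ[ h ] + g q + f p    ≡⟨ cong (_+ f p) (trans (Σ-change₁ q h≗g) (cong (Σ[ g ] +_) hq)) ⟩
    Σ[ g ] + f q + f p    ≡⟨ reassoc Σ[ g ] (f q) (f p) ⟩
    Σ[ g ] + (f p + f q)  ∎
  where
  open ≡-Reasoning
  h : Fin n → ℕ
  h j = if j == p then g p else f j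
  hp : h p ≡ g p
  hp rewrite ==-refl p = refl
  hq : h q ≡ f q
  hq rewrite ==-false (p≢q ∘ sym) = refl
  f≗h : ∀ j → j ≢ p → f j ≡ h j
  f≗h j j≢p rewrite ==-false j≢p = refl
  h≗g : ∀ j → j ≢ q → h j ≡ g j
  h≗g j j≢q with j ≟ p
  ... | yes refl = refl
  ... | no j≢p = f≗g j j≢p j≢q
  rotate : ∀ x y z → x + y + z ≡ x + z + y
  rotate = solve-∀
  reassoc : ∀ x y z → x + y + z ≡ x + (z + y)
  reassoc = solve-∀

Σ-change₂-≡ : ∀ {n} {p q : Fin n} {f g : Fin n → ℕ} → p ≢ q → (∀ j → j ≢ p → j ≢ q → f j ≡ g j) →
              f p + f q ≡ g p + g q → Σ[ f ] ≡ Σ[ g ]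
Σ-change₂-≡ {f = f} {g} p≢q f≗g fpq≡gpq =
  +-cancelʳ-≡ _ Σ[ f ] Σ[ g ] (trans (Σ-change₂ p≢q f≗g) (cong (Σ[ g ] +_) fpq≡gpq))

Σ-concentrated : ∀ {n} (p : Fin n) {f : Fin n → ℕ} → (∀ j → j ≢ p → f j ≡ 0) → Σ[ f ] ≡ f p
Σ-concentrated {n} p {f} f≗0 =
  trans (sym (+-identityʳ _)) (trans (Σ-change₁ p {f} {λ _ → 0} f≗0) (cong (_+ f p) (Σ-zero {n})))

Σ-≥-term : ∀ {n} (f : Fin n → ℕ) (p : Fin n) → f p ≤ Σ[ f ]
Σ-≥-term {n} f p = subst (f p ≤_) f-split (m≤n+m _ Σ[ g ])
  where
  g : Fin n → ℕ
  g j = if j == p then 0 else f j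
  f-split : Σ[ g ] + f p ≡ Σ[ f ]
  f-split = sym (trans (sym (+-identityʳ _)) (trans (cong (Σ[ f ] +_) gp) (Σ-change₁ p {f} {g} f≗g)))
    where
    gp : 0 ≡ g p
    gp rewrite ==-refl p = refl
    f≗g : ∀ j → j ≢ p → f j ≡ g j
    f≗g j j≢p rewrite ==-false j≢p = refl

Σ-≥-two-terms : ∀ {n} (f : Fin n → ℕ) {p q : Fin n} → p ≢ q → f p + f q ≤ Σ[ f ]
Σ-≥-two-terms {n} f {p} {q} p≢q = subst (f p + f q ≤_) f-split (m≤n+m _ Σ[ g ])
  where
  g : Fin n → ℕ
  g j = if (j == p) ∨ (j == q) then 0 else f j
  gpq : 0 ≡ g p + g q
  gpq rewrite ==-refl p | ==-refl q | ==-false (p≢q ∘ sym) = refl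
  f≗g : ∀ j → j ≢ p → j ≢ q → f j ≡ g j
  f≗g j j≢p j≢q rewrite ==-false j≢p | ==-false j≢q = refl
  f-split : Σ[ g ] + (f p + f q) ≡ Σ[ f ]
  f-split = sym (trans (sym (+-identityʳ _)) (trans (cong (Σ[ f ] +_) gpq) (Σ-change₂ p≢q f≗g)))

Σ-permute : ∀ {n} (σ : Fin n ↔ Fin n) (f : Fin n → ℕ) → Σ[ f ∘ Inverse.to σ ] ≡ Σ[ f ]
Σ-permute σ f = trans (Σ≡sum (f ∘ Inverse.to σ)) (trans (sym (sum-permute f σ)) (sym (Σ≡sum f)))
  where
  Σ≡sum : ∀ {n} (f : Fin n → ℕ) → Σ[ f ] ≡ sum f
  Σ≡sum {zero} f = refl
  Σ≡sum {suc n} f = cong (f zero +_) (Σ≡sum (f ∘ suc))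

adjB-sym : ∀ {n} (A : Mat n) i j → adjB A i j ≡ adjB A j i
adjB-sym A i j = ∨-comm (A i j) (A j i)

Adj-sym : ∀ {n} {A : Mat n} {i j} → Adj A i j → Adj A j i
Adj-sym {A = A} {i} {j} = trans (adjB-sym A j i)

Adj⇒≢ : ∀ {n} {A : Mat n} → IsMixedGraph A → ∀ {i j} → Adj A i j → i ≢ j
Adj⇒≢ {A = A} mixed {i} i~i refl with A i i | mixed i
... | .false | refl = true≢false i~i refl

Undir⇒Adj : ∀ {n} {A : Mat n} {i j} → Undir A i j → Adj A i j
Undir⇒Adj (Aij , _) rewrite Aij = refl

Arc⇒Adj : ∀ {n} {A : Mat n} {i j} → Arc A i j → Adj A i j
Arc⇒Adj (Aij , _) rewrite Aij = refl

¬Adj⇒false : ∀ {n} {A : Mat n} {i j} → ¬ Adj A i j → A i j ≡ false × A j i ≡ false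
¬Adj⇒false {A = A} {i} {j} ¬i~j with A i j | A j i
... | false | false = refl , refl
... | true | _ = ⊥-elim (¬i~j refl)
... | false | true = ⊥-elim (¬i~j refl)

Undir⇒¬Arc : ∀ {n} {A : Mat n} {i j} → Undir A i j → ¬ Arc A i j
Undir⇒¬Arc (_ , Aji) (_ , ¬Aji) = true≢false Aji ¬Aji

¬Adj⇒¬Arc : ∀ {n} {A : Mat n} {i j} → ¬ Adj A i j → ¬ Arc A i j
¬Adj⇒¬Arc {A = A} ¬i~j = ¬i~j ∘ Arc⇒Adj {A = A}

¬Arc⇒symmetric : ∀ {n} {A : Mat n} {i j} → ¬ Arc A i j → ¬ Arc A j i → A i j ≡ A j i
¬Arc⇒symmetric {A = A} {i} {j} ¬ij ¬ji with A i j | A j i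
... | true | true = refl
... | false | false = refl
... | true | false = ⊥-elim (¬ij (refl , refl))
... | false | true = ⊥-elim (¬ji (refl , refl))

Adj? : ∀ {n} (A : Mat n) i j → Dec (Adj A i j)
Adj? A i j = adjB A i j ≟ᵇ true

Undir? : ∀ {n} (A : Mat n) i j → Dec (Undir A i j)
Undir? A i j = (A i j ≟ᵇ true) ×-dec (A j i ≟ᵇ true)

Leaf? : ∀ {n} (A : Mat n) i → Dec (Leaf A i)
Leaf? A i = deg A i ≟ℕ 1

Adj⇒1≤deg : ∀ {n} {A : Mat n} {i j} → Adj A i j → 1 ≤ deg A i
Adj⇒1≤deg {A = A} {i} {j} i~j =
  subst (_≤ deg A i) (b2n-true i~j) (Σ-≥-term (λ k → b2n (adjB A i k)) j)

Adj⇒2≤deg : ∀ {n} {A : Mat n} {i j k} → Adj A i j → Adj A i k → j ≢ k → 2 ≤ deg A i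
Adj⇒2≤deg {A = A} {i} i~j i~k j≢k =
  subst (_≤ deg A i) (cong₂ _+_ (b2n-true i~j) (b2n-true i~k)) (Σ-≥-two-terms (λ l → b2n (adjB A i l)) j≢k)

¬Leaf⇒2≤deg : ∀ {n} {A : Mat n} {i j} → Adj A i j → ¬ Leaf A i → 2 ≤ deg A i
¬Leaf⇒2≤deg {A = A} {i} i~j ¬leaf with deg A i | Adj⇒1≤deg {A = A} i~j
... | suc zero | _ = ⊥-elim (¬leaf refl)
... | suc (suc _) | _ = s≤s (s≤s z≤n)

Leaf-neighbour-unique : ∀ {n} {A : Mat n} {i j k} → Leaf A i → Adj A i j → Adj A i k → j ≡ k
Leaf-neighbour-unique {A = A} {j = j} {k} leaf i~j i~k with j ≟ k
... | yes j≡k = j≡k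
... | no j≢k with subst (2 ≤_) leaf (Adj⇒2≤deg {A = A} i~j i~k j≢k)
... | s≤s ()

module _ {n} {A : Mat n} (mixed : IsMixedGraph A) where

  private
    distinct : ∀ {i j} → Adj A i j → i ≢ j
    distinct = Adj⇒≢ {A = A} mixed

  cycle₃ : ∀ {x y z} → Adj A x y → Adj A y z → Adj A z x → HasCycle A
  cycle₃ {x} {y} {z} xy yz zx = x , y ∷ z ∷ [] , s≤s (s≤s z≤n) ,
    ((distinct xy ∷ distinct zx ∘ sym ∷ []) ∷ (distinct yz ∷ []) ∷ [] ∷ []) ,
    (xy ∷ yz ∷ zx ∷ [-])

  cycle₄ : ∀ {x y z w} → Adj A x y → Adj A y z → Adj A z w → Adj A w x → x ≢ z → y ≢ w → HasCycle A
  cycle₄ {x} {y} {z} {w} xy yz zw wx x≢z y≢w = x , y ∷ z ∷ w ∷ [] , s≤s (s≤s z≤n) ,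
    ((distinct xy ∷ x≢z ∷ distinct wx ∘ sym ∷ []) ∷ (distinct yz ∷ y≢w ∷ []) ∷ (distinct zw ∷ []) ∷ [] ∷ []) ,
    (xy ∷ yz ∷ zw ∷ wx ∷ [-])

  cycle₅ : ∀ {x y z w v} → Adj A x y → Adj A y z → Adj A z w → Adj A w v → Adj A v x →
           x ≢ z → x ≢ w → y ≢ w → y ≢ v → z ≢ v → HasCycle A
  cycle₅ {x} {y} {z} {w} {v} xy yz zw wv vx x≢z x≢w y≢w y≢v z≢v = x , y ∷ z ∷ w ∷ v ∷ [] , s≤s (s≤s z≤n) ,
    ((distinct xy ∷ x≢z ∷ x≢w ∷ distinct vx ∘ sym ∷ []) ∷ (distinct yz ∷ y≢w ∷ y≢v ∷ []) ∷
      (distinct zw ∷ z≢v ∷ []) ∷ (distinct wv ∷ []) ∷ [] ∷ []) ,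
    (xy ∷ yz ∷ zw ∷ wv ∷ vx ∷ [-])

Iso-refl : ∀ {n} (A : Mat n) → Iso A A
Iso-refl A = ↔-id _ , λ _ _ → refl

Iso-sym : ∀ {n} {A B : Mat n} → Iso A B → Iso B A
Iso-sym {B = B} (σ , A≅B) = ↔-sym σ , λ i j →
  sym (trans (A≅B (Inverse.from σ i) (Inverse.from σ j))
             (cong₂ B (Inverse.strictlyInverseˡ σ i) (Inverse.strictlyInverseˡ σ j)))

Iso-trans : ∀ {n} {A B C : Mat n} → Iso A B → Iso B C → Iso A C
Iso-trans (σ , A≅B) (τ , B≅C) = τ ↔-∘ σ , λ i j → trans (A≅B i j) (B≅C _ _)

module _ {n} (a b : Fin n) where

  transpose-matchˡ : transpose a b a ≡ b
  transpose-matchˡ rewrite dec-true (a ≟ a) refl = refl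

  transpose-matchʳ : transpose a b b ≡ a
  transpose-matchʳ with b ≟ a
  ... | yes refl = refl
  ... | no b≢a rewrite dec-true (b ≟ b) refl = refl

  transpose-other : ∀ {k} → k ≢ a → k ≢ b → transpose a b k ≡ k
  transpose-other k≢a k≢b rewrite dec-false (_ ≟ a) k≢a | dec-false (_ ≟ b) k≢b = refl

module Kelmans {n} (a b : Fin n) (A : Mat n) (a≢b : a ≢ b) where

  K : Mat n
  K = kelmans a b A

  private
    b≢a : b ≢ a
    b≢a = a≢b ∘ sym

    ∈ab : ∀ {k} → k ≡ a ⊎ k ≡ b → ((k == a) ∨ (k == b)) ≡ true
    ∈ab (inj₁ refl) rewrite ==-refl a = refl
    ∈ab (inj₂ refl) rewrite ==-refl b = ∨-zeroʳ (b == a)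

  kelmans-inside : ∀ {i j} → i ≡ a ⊎ i ≡ b → j ≡ a ⊎ j ≡ b → K i j ≡ A i j
  kelmans-inside i∈ab j∈ab rewrite ∈ab i∈ab | ∈ab j∈ab = refl

  kelmans-outside : ∀ {i j} → i ≢ a → i ≢ b → j ≢ a → j ≢ b → K i j ≡ A i j
  kelmans-outside i≢a i≢b j≢a j≢b rewrite ==-false i≢a | ==-false i≢b | ==-false j≢a | ==-false j≢b = refl

  kelmans-to-a : ∀ {i} → i ≢ a → i ≢ b → K i a ≡ (A i a ∨ A i b)
  kelmans-to-a i≢a i≢b rewrite ==-false i≢a | ==-false i≢b | ==-refl a = refl

  kelmans-to-b : ∀ {i} → i ≢ a → i ≢ b → K i b ≡ (A i a ∧ A i b)
  kelmans-to-b i≢a i≢b rewrite ==-false i≢a | ==-false i≢b | ==-refl b | ==-false b≢a = refl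

  kelmans-from-a : ∀ {j} → j ≢ a → j ≢ b → K a j ≡ (A a j ∨ A b j)
  kelmans-from-a j≢a j≢b rewrite ==-false j≢a | ==-false j≢b | ==-refl a = refl

  kelmans-from-b : ∀ {j} → j ≢ a → j ≢ b → K b j ≡ (A a j ∧ A b j)
  kelmans-from-b j≢a j≢b rewrite ==-false j≢a | ==-false j≢b | ==-refl b | ==-false b≢a = refl

  adj-outside : ∀ {i j} → i ≢ a → i ≢ b → j ≢ a → j ≢ b → adjB K i j ≡ adjB A i j
  adj-outside i≢a i≢b j≢a j≢b =
    cong₂ _∨_ (kelmans-outside i≢a i≢b j≢a j≢b) (kelmans-outside j≢a j≢b i≢a i≢b)

  adj-to-a : ∀ {i} → i ≢ a → i ≢ b → adjB K i a ≡ (adjB A i a ∨ adjB A i b)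
  adj-to-a {i} i≢a i≢b = trans (cong₂ _∨_ (kelmans-to-a i≢a i≢b) (kelmans-from-a i≢a i≢b))
                               (∨-interchange (A i a) (A i b) (A a i) (A b i))

  Adj-to-b : ∀ {i} → i ≢ a → i ≢ b → Adj K i b → Adj A i a × Adj A i b
  Adj-to-b {i} i≢a i≢b i~b = ∧-∨-∧-true (A i a) (A i b) (A a i) (A b i)
    (trans (sym (cong₂ _∨_ (kelmans-to-b i≢a i≢b) (kelmans-from-b i≢a i≢b))) i~b)

  adj-a-b : adjB K a b ≡ adjB A a b
  adj-a-b = cong₂ _∨_ (kelmans-inside (inj₁ refl) (inj₂ refl)) (kelmans-inside (inj₂ refl) (inj₁ refl))

  kelmans-isMixedGraph : IsMixedGraph A → IsMixedGraph K
  kelmans-isMixedGraph mixed i with toSum (i ≟ a) | toSum (i ≟ b)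
  ... | inj₁ i≡a | _ = trans (kelmans-inside (inj₁ i≡a) (inj₁ i≡a)) (mixed i)
  ... | inj₂ _ | inj₁ i≡b = trans (kelmans-inside (inj₂ i≡b) (inj₂ i≡b)) (mixed i)
  ... | inj₂ i≢a | inj₂ i≢b = trans (kelmans-outside i≢a i≢b i≢a i≢b) (mixed i)

  private
    row : Mat n → Fin n → ℕ
    row M i = Σ[ (λ j → b2n (M i j)) ]

    row-outside : ∀ {i} → i ≢ a → i ≢ b → row K i ≡ row A i
    row-outside {i} i≢a i≢b = Σ-change₂-≡ a≢b
      (λ j j≢a j≢b → cong b2n (kelmans-outside i≢a i≢b j≢a j≢b))
      (trans (cong₂ _+_ (cong b2n (kelmans-to-a i≢a i≢b)) (cong b2n (kelmans-to-b i≢a i≢b)))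
             (b2n-∨+∧ (A i a) (A i b)))

    rows-ab : row K a + row K b ≡ row A a + row A b
    rows-ab = trans (sym (Σ-distrib-+ (λ j → b2n (K a j)) (λ j → b2n (K b j))))
                    (trans (Σ-cong entries) (Σ-distrib-+ (λ j → b2n (A a j)) (λ j → b2n (A b j))))
      where
      entries : ∀ j → b2n (K a j) + b2n (K b j) ≡ b2n (A a j) + b2n (A b j)
      entries j with toSum (j ≟ a) | toSum (j ≟ b)
      ... | inj₁ j≡a | _ = cong₂ _+_ (cong b2n (kelmans-inside (inj₁ refl) (inj₁ j≡a)))
                                    (cong b2n (kelmans-inside (inj₂ refl) (inj₁ j≡a)))
      ... | inj₂ _ | inj₁ j≡b = cong₂ _+_ (cong b2n (kelmans-inside (inj₁ refl) (inj₂ j≡b)))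
                                       (cong b2n (kelmans-inside (inj₂ refl) (inj₂ j≡b)))
      ... | inj₂ j≢a | inj₂ j≢b =
        trans (cong₂ _+_ (cong b2n (kelmans-from-a j≢a j≢b)) (cong b2n (kelmans-from-b j≢a j≢b)))
                                    (b2n-∨+∧ (A a j) (A b j))

  size-kelmans : size K ≡ size A
  size-kelmans = Σ-change₂-≡ a≢b (λ i i≢a i≢b → row-outside i≢a i≢b) rows-ab

MiddleShape : ∀ {n} → Mat n → Fin n → Fin n → Fin n → Set
MiddleShape T a b x = Undir T a x ⊎ Undir T x b ⊎ (Arc T a x × Arc T b x) ⊎ (Arc T x a × Arc T x b)

Dominates : ∀ {n} → Mat n → Fin n → Fin n → Set
Dominates {n} T a b = ∀ i → i ≢ a → i ≢ b → (T i b ≡ true → T i a ≡ true) × (T b i ≡ true → T a i ≡ true)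

module _ {n} (T : Mat n) (a b : Fin n) (a≢b : a ≢ b) where

  open Kelmans a b T a≢b

  kelmans-dominated : Dominates T a b → ∀ i j → K i j ≡ T i j
  kelmans-dominated a≥b i j with toSum (i ≟ a) | toSum (i ≟ b) | toSum (j ≟ a) | toSum (j ≟ b)
  ... | inj₁ i≡a | _ | inj₁ j≡a | _ = kelmans-inside (inj₁ i≡a) (inj₁ j≡a)
  ... | inj₁ i≡a | _ | inj₂ _ | inj₁ j≡b = kelmans-inside (inj₁ i≡a) (inj₂ j≡b)
  ... | inj₂ _ | inj₁ i≡b | inj₁ j≡a | _ = kelmans-inside (inj₂ i≡b) (inj₁ j≡a)
  ... | inj₂ _ | inj₁ i≡b | inj₂ _ | inj₁ j≡b = kelmans-inside (inj₂ i≡b) (inj₂ j≡b)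
  ... | inj₂ i≢a | inj₂ i≢b | inj₂ j≢a | inj₂ j≢b = kelmans-outside i≢a i≢b j≢a j≢b
  ... | inj₂ i≢a | inj₂ i≢b | inj₁ refl | _ =
    trans (kelmans-to-a i≢a i≢b) (∨-dominatedʳ (proj₁ (a≥b i i≢a i≢b)))
  ... | inj₂ i≢a | inj₂ i≢b | inj₂ _ | inj₁ refl =
    trans (kelmans-to-b i≢a i≢b) (∧-dominatedʳ (proj₁ (a≥b i i≢a i≢b)))
  ... | inj₁ refl | _ | inj₂ j≢a | inj₂ j≢b =
    trans (kelmans-from-a j≢a j≢b) (∨-dominatedʳ (proj₂ (a≥b j j≢a j≢b)))
  ... | inj₂ _ | inj₁ refl | inj₂ j≢a | inj₂ j≢b =
    trans (kelmans-from-b j≢a j≢b) (∧-dominatedʳ (proj₂ (a≥b j j≢a j≢b)))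

  kelmans-dominating : IsMixedGraph T → T a b ≡ T b a → Dominates T b a →
                       ∀ i j → K i j ≡ T (transpose a b i) (transpose a b j)
  kelmans-dominating mixed Tab≡Tba b≥a i j
    with toSum (i ≟ a) | toSum (i ≟ b) | toSum (j ≟ a) | toSum (j ≟ b)
  ... | inj₁ refl | _ | inj₁ refl | _ =
    trans (kelmans-inside (inj₁ refl) (inj₁ refl))
          (trans (mixed a) (sym (trans (cong₂ T (transpose-matchˡ a b) (transpose-matchˡ a b)) (mixed b))))
  ... | inj₁ refl | _ | inj₂ _ | inj₁ refl =
    trans (kelmans-inside (inj₁ refl) (inj₂ refl))
          (trans Tab≡Tba (sym (cong₂ T (transpose-matchˡ a b) (transpose-matchʳ a b))))
  ... | inj₂ _ | inj₁ refl | inj₁ refl | _ =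
    trans (kelmans-inside (inj₂ refl) (inj₁ refl))
          (trans (sym Tab≡Tba) (sym (cong₂ T (transpose-matchʳ a b) (transpose-matchˡ a b))))
  ... | inj₂ _ | inj₁ refl | inj₂ _ | inj₁ refl =
    trans (kelmans-inside (inj₂ refl) (inj₂ refl))
          (trans (mixed b) (sym (trans (cong₂ T (transpose-matchʳ a b) (transpose-matchʳ a b)) (mixed a))))
  ... | inj₂ i≢a | inj₂ i≢b | inj₂ j≢a | inj₂ j≢b =
    trans (kelmans-outside i≢a i≢b j≢a j≢b)
          (sym (cong₂ T (transpose-other a b i≢a i≢b) (transpose-other a b j≢a j≢b)))
  ... | inj₂ i≢a | inj₂ i≢b | inj₁ refl | _ =
    trans (kelmans-to-a i≢a i≢b) (trans (∨-dominatedˡ (proj₁ (b≥a i i≢b i≢a)))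
          (sym (cong₂ T (transpose-other a b i≢a i≢b) (transpose-matchˡ a b))))
  ... | inj₂ i≢a | inj₂ i≢b | inj₂ _ | inj₁ refl =
    trans (kelmans-to-b i≢a i≢b) (trans (∧-dominatedˡ (proj₁ (b≥a i i≢b i≢a)))
          (sym (cong₂ T (transpose-other a b i≢a i≢b) (transpose-matchʳ a b))))
  ... | inj₁ refl | _ | inj₂ j≢a | inj₂ j≢b =
    trans (kelmans-from-a j≢a j≢b) (trans (∨-dominatedˡ (proj₂ (b≥a j j≢b j≢a)))
          (sym (cong₂ T (transpose-matchˡ a b) (transpose-other a b j≢a j≢b))))
  ... | inj₂ _ | inj₁ refl | inj₂ j≢a | inj₂ j≢b =
    trans (kelmans-from-b j≢a j≢b) (trans (∧-dominatedˡ (proj₂ (b≥a j j≢b j≢a)))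
          (sym (cong₂ T (transpose-matchʳ a b) (transpose-other a b j≢a j≢b))))

  kelmans-Iso : IsMixedGraph T → ¬ Arc T a b → ¬ Arc T b a →
                Dominates T a b ⊎ Dominates T b a → Iso K T
  kelmans-Iso _ _ _ (inj₁ a≥b) = ↔-id _ , kelmans-dominated a≥b
  kelmans-Iso mixed ¬ab ¬ba (inj₂ b≥a) =
    transpositionᵖ a b , kelmans-dominating mixed (¬Arc⇒symmetric {A = T} ¬ab ¬ba) b≥a

module Transport {n} {X T : Mat n} (τ : Fin n ↔ Fin n)
                 (X≅T : ∀ i j → X i j ≡ T (Inverse.to τ i) (Inverse.to τ j)) where

  private
    t : Fin n → Fin n
    t = Inverse.to τ

    t-injective : ∀ {i j} → t i ≡ t j → i ≡ j
    t-injective {i} {j} ti≡tj = trans (sym (Inverse.strictlyInverseʳ τ i))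
                                      (trans (cong (Inverse.from τ) ti≡tj) (Inverse.strictlyInverseʳ τ j))

    ==-transport : ∀ i j → (t i == t j) ≡ (i == j)
    ==-transport i j with toSum (i ≟ j)
    ... | inj₁ refl = trans (==-refl (t i)) (sym (==-refl i))
    ... | inj₂ i≢j = trans (==-false (i≢j ∘ t-injective)) (sym (==-false i≢j))

    Adj⁺ : ∀ {i j} → Adj X i j → Adj T (t i) (t j)
    Adj⁺ {i} {j} = trans (sym (cong₂ _∨_ (X≅T i j) (X≅T j i)))

    Adj⁻ : ∀ {i j} → Adj T (t i) (t j) → Adj X i j
    Adj⁻ {i} {j} = trans (cong₂ _∨_ (X≅T i j) (X≅T j i))

    Undir⁺ : ∀ {i j} → Undir X i j → Undir T (t i) (t j)
    Undir⁺ {i} {j} (Xij , Xji) = trans (sym (X≅T i j)) Xij , trans (sym (X≅T j i)) Xji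

    Arc⁺ : ∀ {i j} → Arc X i j → Arc T (t i) (t j)
    Arc⁺ {i} {j} (Xij , Xji) = trans (sym (X≅T i j)) Xij , trans (sym (X≅T j i)) Xji

    Arc⁻ : ∀ {i j} → Arc T (t i) (t j) → Arc X i j
    Arc⁻ {i} {j} (Tij , Tji) = trans (X≅T i j) Tij , trans (X≅T j i) Tji

  kelmans-transport : ∀ a b i j → kelmans a b X i j ≡ kelmans (t a) (t b) T (t i) (t j)
  kelmans-transport a b i j
    rewrite ==-transport i a | ==-transport i b | ==-transport j a | ==-transport j b
          | X≅T i j | X≅T a j | X≅T b j | X≅T i a | X≅T i b = refl

  Admissible-transport : ∀ {a b} → Admissible X a b → Admissible T (t a) (t b)
  Admissible-transport (a≢b , ¬ab , ¬ba , inj₁ ab) = a≢b ∘ t-injective , ¬ab ∘ Arc⁻ , ¬ba ∘ Arc⁻ , inj₁ (Undir⁺ ab)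
  Admissible-transport {a} {b} (a≢b , ¬ab , ¬ba , inj₂ (¬a~b , x , a~x , x~b , shape)) =
    a≢b ∘ t-injective , ¬ab ∘ Arc⁻ , ¬ba ∘ Arc⁻ , inj₂ (¬a~b ∘ Adj⁻ , t x , Adj⁺ a~x , Adj⁺ x~b , shape⁺ shape)
    where
    shape⁺ : MiddleShape X a b x → MiddleShape T (t a) (t b) (t x)
    shape⁺ (inj₁ ax) = inj₁ (Undir⁺ ax)
    shape⁺ (inj₂ (inj₁ xb)) = inj₂ (inj₁ (Undir⁺ xb))
    shape⁺ (inj₂ (inj₂ (inj₁ (ax , bx)))) = inj₂ (inj₂ (inj₁ (Arc⁺ ax , Arc⁺ bx)))
    shape⁺ (inj₂ (inj₂ (inj₂ (xa , xb)))) = inj₂ (inj₂ (inj₂ (Arc⁺ xa , Arc⁺ xb)))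

¬Adj⇒dominated : ∀ {n} {T : Mat n} {a b i} → ¬ Adj T b i →
                 (T i b ≡ true → T i a ≡ true) × (T b i ≡ true → T a i ≡ true)
¬Adj⇒dominated {T = T} ¬b~i =
  (λ Tib → ⊥-elim (true≢false Tib (proj₂ (¬Adj⇒false {A = T} ¬b~i)))) ,
  (λ Tbi → ⊥-elim (true≢false Tbi (proj₁ (¬Adj⇒false {A = T} ¬b~i))))

dominates-via : ∀ {n} {T : Mat n} {a b} x → (∀ i → i ≢ a → i ≢ b → i ≢ x → ¬ Adj T b i) →
                (T x b ≡ true → T x a ≡ true) → (T b x ≡ true → T a x ≡ true) → Dominates T a b
dominates-via {T = T} x only-x xb⇒xa bx⇒ax i i≢a i≢b with toSum (i ≟ x)
... | inj₁ refl = xb⇒xa , bx⇒ax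
... | inj₂ i≢x = ¬Adj⇒dominated {T = T} (only-x i i≢a i≢b i≢x)

module _ {n} {T : Mat n} (star : IsMixedStar T) where

  private
    mixed : IsMixedGraph T
    mixed = proj₁ (proj₁ star)
    acyclic : ¬ HasCycle T
    acyclic = proj₂ (proj₂ (proj₁ star))
    diameter≤2 : (i j : Fin n) → i ≡ j ⊎ Adj T i j ⊎ Σ (Fin n) λ x → Adj T i x × Adj T x j
    diameter≤2 = proj₂ star
    sym~ : ∀ {i j} → Adj T i j → Adj T j i
    sym~ = Adj-sym {A = T}

  star-adjacent-dominated : ∀ {a b j} → Adj T a b → j ≢ a → j ≢ b → Adj T b j →
                            ∀ i → i ≢ a → i ≢ b → ¬ Adj T a i
  star-adjacent-dominated {a} {b} {j} a~b j≢a j≢b b~j i i≢a i≢b a~i with toSum (i ≟ j)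
  ... | inj₁ refl = acyclic (cycle₃ {A = T} mixed a~b b~j (sym~ a~i))
  ... | inj₂ i≢j with diameter≤2 i j
  ...   | inj₁ i≡j = i≢j i≡j
  ...   | inj₂ (inj₁ i~j) = acyclic (cycle₄ {A = T} mixed (sym~ a~i) a~b b~j (sym~ i~j) i≢b (j≢a ∘ sym))
  ...   | inj₂ (inj₂ (y , i~y , y~j)) with toSum (y ≟ a) | toSum (y ≟ b)
  ...     | inj₁ refl | _ = acyclic (cycle₃ {A = T} mixed a~b b~j (sym~ y~j))
  ...     | inj₂ _ | inj₁ refl = acyclic (cycle₃ {A = T} mixed a~b (sym~ i~y) (sym~ a~i))
  ...     | inj₂ y≢a | inj₂ y≢b = acyclic (cycle₅ {A = T} mixed (sym~ a~i) a~b b~j (sym~ y~j) (sym~ i~y)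
                                     i≢b i≢j (j≢a ∘ sym) (y≢a ∘ sym) (y≢b ∘ sym))

  star-distance-two-dominated : ∀ {u w x} → ¬ Adj T u w → Adj T u x → Adj T x w → u ≢ w →
                                ∀ i → i ≢ u → i ≢ w → i ≢ x → ¬ Adj T u i
  star-distance-two-dominated {u} {w} {x} ¬u~w u~x x~w u≢w i i≢u i≢w i≢x u~i with diameter≤2 i w
  ... | inj₁ i≡w = i≢w i≡w
  ... | inj₂ (inj₁ i~w) = acyclic (cycle₄ {A = T} mixed (sym~ u~i) u~x x~w (sym~ i~w) i≢x u≢w)
  ... | inj₂ (inj₂ (y , i~y , y~w)) with toSum (y ≟ u) | toSum (y ≟ x)
  ...   | inj₁ refl | _ = ¬u~w y~w
  ...   | inj₂ _ | inj₁ refl = acyclic (cycle₃ {A = T} mixed (sym~ u~i) u~x (sym~ i~y))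
  ...   | inj₂ y≢u | inj₂ y≢x = acyclic (cycle₅ {A = T} mixed (sym~ u~i) u~x x~w (sym~ y~w) (sym~ i~y)
                                   i≢x i≢w u≢w (y≢u ∘ sym) (y≢x ∘ sym))

  star-domination : ∀ {a b} → Admissible T a b → Dominates T a b ⊎ Dominates T b a
  star-domination {a} {b} (a≢b , _ , _ , inj₁ ab)
    with any? (λ j → ¬? (j ≟ a) ×-dec ¬? (j ≟ b) ×-dec Adj? T b j)
  ... | no b-pendant = inj₁ λ i i≢a i≢b → ¬Adj⇒dominated {T = T} λ b~i → b-pendant (i , i≢a , i≢b , b~i)
  ... | yes (j , j≢a , j≢b , b~j) =
    inj₂ λ i i≢b i≢a →
      ¬Adj⇒dominated {T = T} (star-adjacent-dominated (Undir⇒Adj {A = T} ab) j≢a j≢b b~j i i≢a i≢b)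
  star-domination {a} {b} (a≢b , _ , _ , inj₂ (¬a~b , x , a~x , x~b , shape)) = by-shape shape
    where
    b-only-x : ∀ i → i ≢ a → i ≢ b → i ≢ x → ¬ Adj T b i
    b-only-x i i≢a i≢b i≢x =
      star-distance-two-dominated (¬a~b ∘ sym~) (sym~ x~b) (sym~ a~x) (a≢b ∘ sym) i i≢b i≢a i≢x
    a-only-x : ∀ i → i ≢ b → i ≢ a → i ≢ x → ¬ Adj T a i
    a-only-x i i≢b i≢a i≢x = star-distance-two-dominated ¬a~b a~x x~b a≢b i i≢a i≢b i≢x
    by-shape : MiddleShape T a b x → Dominates T a b ⊎ Dominates T b a
    by-shape (inj₁ (Tax , Txa)) = inj₁ (dominates-via x b-only-x (λ _ → Txa) (λ _ → Tax))
    by-shape (inj₂ (inj₁ (Txb , Tbx))) = inj₂ (dominates-via x a-only-x (λ _ → Txb) (λ _ → Tbx))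
    by-shape (inj₂ (inj₂ (inj₁ ((Tax , _) , (_ , ¬Txb))))) =
      inj₁ (dominates-via x b-only-x (λ Txb → ⊥-elim (true≢false Txb ¬Txb)) (λ _ → Tax))
    by-shape (inj₂ (inj₂ (inj₂ ((Txa , _) , (_ , ¬Tbx))))) =
      inj₁ (dominates-via x b-only-x (λ _ → Txa) (λ Tbx → ⊥-elim (true≢false Tbx ¬Tbx)))

Leaf-dominated : ∀ {n} {T : Mat n} {a b x} → Leaf T b → Adj T x b →
                 (Arc T a x × Arc T b x) ⊎ (Arc T x a × Arc T x b) → Dominates T a b
Leaf-dominated {T = T} {a} {b} {x} leaf-b x~b arcs = dominates-via x only-x (xb⇒xa arcs) (bx⇒ax arcs)
  where
  only-x : ∀ i → i ≢ a → i ≢ b → i ≢ x → ¬ Adj T b i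
  only-x i _ _ i≢x b~i = i≢x (sym (Leaf-neighbour-unique {A = T} leaf-b (Adj-sym {A = T} x~b) b~i))
  xb⇒xa : (Arc T a x × Arc T b x) ⊎ (Arc T x a × Arc T x b) → T x b ≡ true → T x a ≡ true
  xb⇒xa (inj₁ (_ , (_ , ¬Txb))) Txb = ⊥-elim (true≢false Txb ¬Txb)
  xb⇒xa (inj₂ ((Txa , _) , _)) _ = Txa
  bx⇒ax : (Arc T a x × Arc T b x) ⊎ (Arc T x a × Arc T x b) → T b x ≡ true → T a x ≡ true
  bx⇒ax (inj₁ ((Tax , _) , _)) _ = Tax
  bx⇒ax (inj₂ (_ , (_ , ¬Tbx))) Tbx = ⊥-elim (true≢false Tbx ¬Tbx)

module _ {n} {T : Mat n} (tree : IsMixedTree T) (no-undirected : NoUndirected T) (leaf-condition : ArcPairCond T) where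

  arcTree-domination : ∀ {a b} → Admissible T a b → Dominates T a b ⊎ Dominates T b a
  arcTree-domination (_ , _ , _ , inj₁ ab) = ⊥-elim (no-undirected _ _ ab)
  arcTree-domination (_ , _ , _ , inj₂ (_ , _ , _ , _ , inj₁ ax)) = ⊥-elim (no-undirected _ _ ax)
  arcTree-domination (_ , _ , _ , inj₂ (_ , _ , _ , _ , inj₂ (inj₁ xb))) = ⊥-elim (no-undirected _ _ xb)
  arcTree-domination {a} {b} (a≢b , _ , _ , inj₂ (_ , x , a~x , x~b , inj₂ (inj₂ arcs)))
    with leaf-condition a b x a≢b (Adj⇒≢ {A = T} (proj₁ tree) a~x) (Adj⇒≢ {A = T} (proj₁ tree) x~b ∘ sym) arcs
  ... | inj₂ leaf-b = inj₁ (Leaf-dominated {T = T} leaf-b x~b arcs)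
  ... | inj₁ leaf-a = inj₂ (Leaf-dominated {T = T} leaf-a (Adj-sym {A = T} a~x) (Sum.map swap swap arcs))

module _ {n} {T : Mat n} (tree : IsMixedTree T)
         (dominated : ∀ {a b} → Admissible T a b → Dominates T a b ⊎ Dominates T b a) where

  KStep-Iso : ∀ {X Y} → Iso T X → KStep X Y → Iso T Y
  KStep-Iso {X} {Y} T≅X (_ , a , b , admissible , Y≅K) with Iso-sym T≅X
  ... | τ , X≅T =
    Iso-sym {A = Y} (Iso-trans {B = kelmans a b X} {C = T} Y≅K (Iso-trans {C = T} (τ , kelmans-transport a b) K′≅T))
    where
    open Transport {X = X} {T = T} τ X≅T
    K′≅T : Iso (kelmans (Inverse.to τ a) (Inverse.to τ b) T) T
    K′≅T with Admissible-transport admissible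
    ... | admissible′@(a′≢b′ , ¬a′b′ , ¬b′a′ , _) =
      kelmans-Iso T _ _ a′≢b′ (proj₁ tree) ¬a′b′ ¬b′a′ (dominated admissible′)

  ≼-Iso : ∀ {X Y} → Iso T X → X ≼ Y → Iso T Y
  ≼-Iso T≅X ε = T≅X
  ≼-Iso {X} T≅X (_◅_ {j = Z} (inj₁ X≅Z) Z≼Y) = ≼-Iso (Iso-trans {A = T} {B = X} {C = Z} T≅X X≅Z) Z≼Y
  ≼-Iso T≅X (inj₂ X→Z ◅ Z≼Y) = ≼-Iso (KStep-Iso T≅X X→Z) Z≼Y

  dominated⇒maximal : ∀ m → IsMaximal m T
  dominated⇒maximal _ _ _ _ T≼B = ≼-Iso (Iso-refl T) T≼B

module _ {A : Set} where

  Unique-++⁻ˡ : ∀ xs {ys : List A} → Unique (xs ++ ys) → Unique xs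
  Unique-++⁻ˡ [] _ = []
  Unique-++⁻ˡ (x ∷ xs) (x∉ ∷ xs!) = All.tabulate (λ m → All.lookup x∉ (∈-++⁺ˡ m)) ∷ Unique-++⁻ˡ xs xs!

  Unique-++⁻ʳ : ∀ xs {ys : List A} → Unique (xs ++ ys) → Unique ys
  Unique-++⁻ʳ [] ys! = ys!
  Unique-++⁻ʳ (x ∷ xs) (_ ∷ xs!) = Unique-++⁻ʳ xs xs!

  Unique-++⇒Disjoint : ∀ xs {ys : List A} → Unique (xs ++ ys) → Disjoint xs ys
  Unique-++⇒Disjoint (x ∷ xs) (x∉ ∷ _) (here refl , m) = All.lookup x∉ (∈-++⁺ʳ xs m) refl
  Unique-++⇒Disjoint (x ∷ xs) (_ ∷ xs!) (there m , m′) = Unique-++⇒Disjoint xs xs! (m , m′)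

  Unique-++-comm : ∀ xs {ys : List A} → Unique (xs ++ ys) → Unique (ys ++ xs)
  Unique-++-comm xs u = Unique.++⁺ (Unique-++⁻ʳ xs u) (Unique-++⁻ˡ xs u) (λ (m , m′) → Unique-++⇒Disjoint xs u (m′ , m))

  last′ : A → List A → A
  last′ p [] = p
  last′ p (r ∷ rs) = last′ r rs

  last′-++ : ∀ p xs {w : A} ys → last′ p (xs ++ w ∷ ys) ≡ last′ w ys
  last′-++ p [] ys = refl
  last′-++ p (x ∷ xs) ys = last′-++ x xs ys

  last′-∈ : ∀ (r : A) rs → last′ r rs ∈ r ∷ rs
  last′-∈ r [] = here refl
  last′-∈ r (s ∷ rs) = there (last′-∈ s rs)

  module _ {R : A → A → Set} where

    Linked-split : ∀ xs {w : A} {ys} → Linked R (xs ++ w ∷ ys) → Linked R (xs ++ [ w ]) × Linked R (w ∷ ys)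
    Linked-split [] l = [-] , l
    Linked-split (x ∷ []) (r ∷ l) = (r ∷ [-]) , l
    Linked-split (x ∷ y ∷ xs) (r ∷ l) = (r ∷ proj₁ (Linked-split (y ∷ xs) l)) , proj₂ (Linked-split (y ∷ xs) l)

    Linked-join : ∀ xs {w : A} {ys} → Linked R (xs ++ [ w ]) → Linked R (w ∷ ys) → Linked R (xs ++ w ∷ ys)
    Linked-join [] _ l = l
    Linked-join (x ∷ []) (r ∷ _) l = r ∷ l
    Linked-join (x ∷ y ∷ xs) (r ∷ l₁) l₂ = r ∷ Linked-join (y ∷ xs) l₁ l₂

    Linked-extend : ∀ {p} rest {w ys} → Linked R (p ∷ rest) → R (last′ p rest) w → Linked R (w ∷ ys) →
                    Linked R (p ∷ rest ++ w ∷ ys)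
    Linked-extend [] _ r l = r ∷ l
    Linked-extend (s ∷ rest) (r₀ ∷ l) r l′ = r₀ ∷ Linked-extend rest l r l′

    Linked-snoc : ∀ {p} rest {w} → Linked R (p ∷ rest) → R (last′ p rest) w → Linked R (p ∷ rest ++ [ w ])
    Linked-snoc rest l r = Linked-extend rest l r [-]

    Linked-unsnoc : ∀ {p} rest {w} → Linked R (p ∷ rest ++ [ w ]) → Linked R (p ∷ rest) × R (last′ p rest) w
    Linked-unsnoc [] (r ∷ _) = [-] , r
    Linked-unsnoc (s ∷ rest) (r ∷ l) = (r ∷ proj₁ (Linked-unsnoc rest l)) , proj₂ (Linked-unsnoc rest l)

    Linked-mapᴬ : ∀ {S : A → A → Set} {P : A → Set} → (∀ {x y} → P x → P y → R x y → S x y) →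
                  ∀ {xs} → All P xs → Linked R xs → Linked S xs
    Linked-mapᴬ f [] [] = []
    Linked-mapᴬ f (_ ∷ []) [-] = [-]
    Linked-mapᴬ f (px ∷ py ∷ ps) (r ∷ l) = f px py r ∷ Linked-mapᴬ f (py ∷ ps) l

  Cycle : (A → A → Set) → A → List A → Set
  Cycle R c ws = Unique (c ∷ ws) × Linked R (c ∷ ws ++ [ c ]) × 2 ≤ length ws

  rotate-Cycle : ∀ {R : A → A → Set} {v vs c} → Cycle R v vs → c ∈ v ∷ vs →
                 Σ (List A) λ ws → Cycle R c ws × (∀ {y} → y ∈ c ∷ ws → y ∈ v ∷ vs)
  rotate-Cycle {vs = vs} cycle (here refl) = vs , cycle , λ m → m
  rotate-Cycle {R} {v} {vs} {c} (u , l , len) (there m) with ∈-∃++ m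
  ... | ys , zs , refl = zs ++ v ∷ ys , (u′ , l′ , len′) , back
    where
    split : Linked R (v ∷ ys ++ [ c ]) × Linked R (c ∷ zs ++ [ v ])
    split = Linked-split (v ∷ ys) (subst (λ z → Linked R (v ∷ z)) (++-assoc ys (c ∷ zs) [ v ]) l)
    l′ : Linked R (c ∷ (zs ++ v ∷ ys) ++ [ c ])
    l′ = subst (λ z → Linked R (c ∷ z)) (sym (++-assoc zs (v ∷ ys) [ c ]))
               (Linked-join (c ∷ zs) (proj₂ split) (proj₁ split))
    u′ : Unique (c ∷ zs ++ v ∷ ys)
    u′ = Unique-++-comm (v ∷ ys) u
    len′ : 2 ≤ length (zs ++ v ∷ ys)
    len′ = subst (2 ≤_) (trans (length-++-comm ys (c ∷ zs))
                         (trans (cong suc (length-++-comm zs ys)) (length-++-comm (v ∷ ys) zs))) len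
    back : ∀ {y} → y ∈ c ∷ zs ++ v ∷ ys → y ∈ v ∷ ys ++ c ∷ zs
    back m with ∈-++⁻ (c ∷ zs) m
    ... | inj₁ m₁ = ∈-++⁺ʳ (v ∷ ys) m₁
    ... | inj₂ m₂ = ∈-++⁺ˡ m₂

Outside : ∀ {n} → Fin n → Fin n → Fin n → Set
Outside a b y = y ≢ a × y ≢ b

PathClosesCycle : ∀ {n} → Mat n → Fin n → Fin n → Fin n → Fin n → Set
PathClosesCycle {n} T a b u w = ∀ p rest → 1 ≤ length rest → Unique (p ∷ rest) → All (Outside a b) (p ∷ rest) →
  Linked (Adj T) (p ∷ rest) → Adj T u p → Adj T (last′ p rest) w → HasCycle T

module KelmansTree {n} {T : Mat n} (tree : IsMixedTree T) {a b : Fin n} (a≢b : a ≢ b) where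

  open Kelmans a b T a≢b
  open DecMembership (_≟_ {n}) using (_∈?_)

  private
    acyclic : ¬ HasCycle T
    acyclic = proj₂ (proj₂ tree)

    T-edge : ∀ {y z} → Outside a b y → Outside a b z → Adj K y z → Adj T y z
    T-edge (y≢a , y≢b) (z≢a , z≢b) y~z = trans (sym (adj-outside y≢a y≢b z≢a z≢b)) y~z

    T-edge-to-a : ∀ {p} → Outside a b p → Adj K p a → Adj T p a ⊎ Adj T p b
    T-edge-to-a (p≢a , p≢b) p~a = ∨-true (trans (sym (adj-to-a p≢a p≢b)) p~a)

  module _ (c : Fin n) (b-pendant : ∀ i → Adj K b i → i ≡ c)
           (closes-ab : PathClosesCycle T a b a b) (closes-ba : PathClosesCycle T a b b a) where

    private
      b∉Cycle : ∀ {v vs} → Cycle (Adj K) v vs → b ∉ v ∷ vs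
      b∉Cycle cycle b∈ with rotate-Cycle cycle b∈
      ... | p ∷ r ∷ rs , ((_ ∷ p∉ ∷ _) , b~p ∷ l , _) , _ =
        All.lookup p∉ (last′-∈ r rs)
          (trans (b-pendant p b~p)
                 (sym (b-pendant _ (Adj-sym {A = K} {i = last′ r rs} {j = b} (proj₂ (Linked-unsnoc (r ∷ rs) l))))))
      ... | [] , (_ , _ , ()) , _
      ... | _ ∷ [] , (_ , _ , s≤s ()) , _

    -- b is a leaf of K, so a cycle of K avoids b. If it also avoids a it is a cycle of T; otherwise the
    -- two neighbours of a on it are joined in T to a or b, and the path between them closes a cycle of T.
    kelmans-acyclic : ¬ HasCycle K
    kelmans-acyclic (v , vs , len , u , l) with a ∈? v ∷ vs
    ... | no a∉ = acyclic (v , vs , len , u , Linked-mapᴬ T-edge (All.tabulate outside) l)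
      where
      outside-cycle : ∀ {y} → y ∈ v ∷ vs → Outside a b y
      outside-cycle y∈ = (λ { refl → a∉ y∈ }) , (λ { refl → b∉Cycle (u , l , len) y∈ })
      outside : ∀ {y} → y ∈ v ∷ vs ++ [ v ] → Outside a b y
      outside y∈ with ∈-++⁻ (v ∷ vs) y∈
      ... | inj₁ y∈′ = outside-cycle y∈′
      ... | inj₂ (here refl) = outside-cycle (here refl)
    ... | yes a∈ with rotate-Cycle (u , l , len) a∈
    ...   | [] , (_ , _ , ()) , _
    ...   | _ ∷ [] , (_ , _ , s≤s ()) , _
    ...   | p ∷ r ∷ rs , ((a∉ ∷ u′) , a~p ∷ l′ , len′) , back =
      close (T-edge-to-a (outside (here refl)) (Adj-sym {A = K} {i = a} {j = p} a~p))
            (T-edge-to-a (outside (last′-∈ p (r ∷ rs))) (proj₂ l-unsnoc))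
      where
      ws : List (Fin n)
      ws = p ∷ r ∷ rs
      outside : ∀ {y} → y ∈ ws → Outside a b y
      outside y∈ = (λ { refl → All.lookup a∉ y∈ refl }) , (λ { refl → b∉Cycle (u , l , len) (back (there y∈)) })
      l-unsnoc : Linked (Adj K) ws × Adj K (last′ r rs) a
      l-unsnoc = Linked-unsnoc (r ∷ rs) l′
      path : Linked (Adj T) ws
      path = Linked-mapᴬ T-edge (All.tabulate outside) (proj₁ l-unsnoc)
      close : Adj T p a ⊎ Adj T p b → Adj T (last′ r rs) a ⊎ Adj T (last′ r rs) b → ⊥
      close (inj₁ p~a) (inj₁ q~a) =
        acyclic (a , ws , len′ , a∉ ∷ u′ , Adj-sym {A = T} p~a ∷ Linked-snoc (r ∷ rs) path q~a)
      close (inj₂ p~b) (inj₂ q~b) =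
        acyclic (b , ws , len′ , All.tabulate (λ y∈ b≡y → proj₂ (outside y∈) (sym b≡y)) ∷ u′ ,
                 Adj-sym {A = T} p~b ∷ Linked-snoc (r ∷ rs) path q~b)
      close (inj₁ p~a) (inj₂ q~b) =
        acyclic (closes-ab p (r ∷ rs) (s≤s z≤n) u′ (All.tabulate outside) path (Adj-sym {A = T} p~a) q~b)
      close (inj₂ p~b) (inj₁ q~a) =
        acyclic (closes-ba p (r ∷ rs) (s≤s z≤n) u′ (All.tabulate outside) path (Adj-sym {A = T} p~b) q~a)

  module _ (a⇝b : Star (Adj K) a b) where

    private
      b⇝a : Star (Adj K) b a
      b⇝a = reverse (λ {i} {j} → Adj-sym {A = K} {i = i} {j = j}) a⇝b

      to-a : ∀ {u} → Outside a b u → Adj T u a ⊎ Adj T u b → Adj K u a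
      to-a (u≢a , u≢b) (inj₁ u~a) rewrite adj-to-a u≢a u≢b | u~a = refl
      to-a {u} (u≢a , u≢b) (inj₂ u~b) rewrite adj-to-a u≢a u≢b | u~b = ∨-zeroʳ (adjB T u a)

      from-a : ∀ {u} → Outside a b u → Adj T a u ⊎ Adj T b u → Adj K a u
      from-a {u} out a~u⊎b~u =
        Adj-sym {A = K} {i = u} {j = a} (to-a out (Sum.map (Adj-sym {A = T}) (Adj-sym {A = T}) a~u⊎b~u))

      -- Edges of T at b are rerouted through a and a ⇝ b.
      edge⇒path : ∀ {u v} → Adj T u v → Star (Adj K) u v
      edge⇒path {u} {v} u~v with toSum (u ≟ a) | toSum (u ≟ b) | toSum (v ≟ a) | toSum (v ≟ b)
      ... | inj₁ refl | _ | inj₁ refl | _ = ⊥-elim (Adj⇒≢ {A = T} (proj₁ tree) u~v refl)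
      ... | inj₁ refl | _ | inj₂ _ | inj₁ refl = a⇝b
      ... | inj₂ _ | inj₁ refl | inj₁ refl | _ = b⇝a
      ... | inj₂ _ | inj₁ refl | inj₂ _ | inj₁ refl = ⊥-elim (Adj⇒≢ {A = T} (proj₁ tree) u~v refl)
      ... | inj₂ u≢a | inj₂ u≢b | inj₂ v≢a | inj₂ v≢b = trans (adj-outside u≢a u≢b v≢a v≢b) u~v ◅ ε
      ... | inj₂ u≢a | inj₂ u≢b | inj₁ refl | _ = to-a (u≢a , u≢b) (inj₁ u~v) ◅ ε
      ... | inj₂ u≢a | inj₂ u≢b | inj₂ _ | inj₁ refl = to-a (u≢a , u≢b) (inj₂ u~v) ◅ a⇝b
      ... | inj₁ refl | _ | inj₂ v≢a | inj₂ v≢b = from-a (v≢a , v≢b) (inj₁ u~v) ◅ ε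
      ... | inj₂ _ | inj₁ refl | inj₂ v≢a | inj₂ v≢b = b⇝a ◅◅ (from-a (v≢a , v≢b) (inj₂ u~v) ◅ ε)

    kelmans-connected : Connected K
    kelmans-connected i j = (edge⇒path ⋆) (proj₁ (proj₂ tree) i j)

  kelmans-isMixedTree : (c : Fin n) → (∀ i → Adj K b i → i ≡ c) →
                        PathClosesCycle T a b a b → PathClosesCycle T a b b a →
                        Star (Adj K) a b → IsMixedTree K
  kelmans-isMixedTree c b-pendant closes-ab closes-ba a⇝b =
    kelmans-isMixedGraph (proj₁ tree) , kelmans-connected a⇝b , kelmans-acyclic c b-pendant closes-ab closes-ba

module _ {n} {T : Mat n} {a b : Fin n} where

  open DecMembership (_≟_ {n}) using (_∈?_)

  private
    ∈ab⇒≢Outside : ∀ {u} → u ≡ a ⊎ u ≡ b → ∀ {y} → Outside a b y → u ≢ y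
    ∈ab⇒≢Outside (inj₁ refl) (y≢a , _) = y≢a ∘ sym
    ∈ab⇒≢Outside (inj₂ refl) (_ , y≢b) = y≢b ∘ sym

    1≤length-++ : ∀ (ys : List (Fin n)) {x zs} → 1 ≤ length (ys ++ x ∷ zs)
    1≤length-++ [] = s≤s z≤n
    1≤length-++ (_ ∷ _) = s≤s z≤n

  closes-cycle-adjacent : ∀ {u w} → u ≡ a ⊎ u ≡ b → w ≡ a ⊎ w ≡ b → u ≢ w → Adj T w u → PathClosesCycle T a b u w
  closes-cycle-adjacent {u} {w} u∈ab w∈ab u≢w w~u p (r ∷ rs) _ unique outside path u~p q~w =
    u , p ∷ r ∷ rs ++ [ w ] , s≤s (s≤s z≤n) ,
    All.tabulate u∉ ∷ Unique.++⁺ unique ([] ∷ []) disjoint ,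
    u~p ∷ Linked-snoc (r ∷ rs ++ [ w ]) (Linked-snoc (r ∷ rs) path q~w)
                      (subst (λ z → Adj T z u) (sym (last′-++ p (r ∷ rs) [])) w~u)
    where
    u∉ : ∀ {y} → y ∈ p ∷ r ∷ rs ++ [ w ] → u ≢ y
    u∉ y∈ with ∈-++⁻ (p ∷ r ∷ rs) y∈
    ... | inj₁ y∈path = ∈ab⇒≢Outside u∈ab (All.lookup outside y∈path)
    ... | inj₂ (here refl) = u≢w
    disjoint : Disjoint (p ∷ r ∷ rs) [ w ]
    disjoint (y∈path , here refl) = ∈ab⇒≢Outside w∈ab (All.lookup outside y∈path) refl

  -- When the middle vertex x lies on the path, the path up to x already closes a cycle with u or w.
  closes-cycle-via : ∀ {u w x} → u ≡ a ⊎ u ≡ b → w ≡ a ⊎ w ≡ b → u ≢ w → Adj T u x → Adj T x w →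
                     u ≢ x → w ≢ x → PathClosesCycle T a b u w
  closes-cycle-via {u} {w} {x} u∈ab w∈ab u≢w u~x x~w u≢x w≢x p rest 1≤len unique outside path u~p q~w
    with x ∈? p ∷ rest
  ... | no x∉ = u , p ∷ rest ++ w ∷ x ∷ [] , s≤s (1≤length-++ rest) ,
    All.tabulate u∉ ∷ Unique.++⁺ unique ((w≢x ∷ []) ∷ [] ∷ []) disjoint ,
    u~p ∷ Linked-snoc (rest ++ w ∷ x ∷ []) (Linked-extend rest path q~w (Adj-sym {A = T} x~w ∷ [-]))
                      (subst (λ z → Adj T z u) (sym (last′-++ p rest (x ∷ []))) (Adj-sym {A = T} u~x))
    where
    u∉ : ∀ {y} → y ∈ p ∷ rest ++ w ∷ x ∷ [] → u ≢ y
    u∉ y∈ with ∈-++⁻ (p ∷ rest) y∈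
    ... | inj₁ y∈path = ∈ab⇒≢Outside u∈ab (All.lookup outside y∈path)
    ... | inj₂ (here refl) = u≢w
    ... | inj₂ (there (here refl)) = u≢x
    disjoint : Disjoint (p ∷ rest) (w ∷ x ∷ [])
    disjoint (y∈path , here refl) = ∈ab⇒≢Outside w∈ab (All.lookup outside y∈path) refl
    disjoint (x∈path , there (here refl)) = x∉ x∈path
  ... | yes x∈ with ∈-∃++ x∈
  ...   | [] , zs , p∷rest≡ with ∷-injective p∷rest≡
  ...     | refl , refl =
    w , p ∷ rest , s≤s 1≤len , All.tabulate (λ y∈ → ∈ab⇒≢Outside w∈ab (All.lookup outside y∈)) ∷ unique ,
    Adj-sym {A = T} x~w ∷ Linked-snoc rest path q~w
  closes-cycle-via {u} {w} {x} u∈ab w∈ab u≢w u~x x~w u≢x w≢x p rest 1≤len unique outside path u~p q~w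
    | yes x∈ | _ ∷ ys , zs , p∷rest≡ with ∷-injective p∷rest≡
  ...     | refl , refl =
    u , p ∷ ys ++ [ x ] , s≤s (1≤length-++ ys) , All.tabulate u∉ ∷ unique′ ,
    u~p ∷ Linked-snoc (ys ++ [ x ]) (proj₁ (Linked-split (p ∷ ys) path))
                      (subst (λ z → Adj T z u) (sym (last′-++ p ys [])) (Adj-sym {A = T} u~x))
    where
    ⊆path : ∀ {y} → y ∈ p ∷ ys ++ [ x ] → y ∈ p ∷ ys ++ x ∷ zs
    ⊆path y∈ with ∈-++⁻ (p ∷ ys) y∈
    ... | inj₁ y∈ys = ∈-++⁺ˡ y∈ys
    ... | inj₂ (here refl) = ∈-++⁺ʳ (p ∷ ys) (here refl)
    u∉ : ∀ {y} → y ∈ p ∷ ys ++ [ x ] → u ≢ y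
    u∉ y∈ = ∈ab⇒≢Outside u∈ab (All.lookup outside (⊆path y∈))
    unique′ : Unique (p ∷ ys ++ [ x ])
    unique′ = Unique-++⁻ˡ (p ∷ ys ++ [ x ]) {zs} (subst Unique (sym (++-assoc (p ∷ ys) [ x ] zs)) unique)

module AdjacentMove {n} {T : Mat n} (tree : IsMixedTree T) {a b : Fin n} (a~b : Adj T a b) where

  private
    mixed : IsMixedGraph T
    mixed = proj₁ tree
    acyclic : ¬ HasCycle T
    acyclic = proj₂ (proj₂ tree)

  a≢b : a ≢ b
  a≢b = Adj⇒≢ {A = T} mixed a~b

  open Kelmans a b T a≢b public

  b-pendant : ∀ i → Adj K b i → i ≡ a
  b-pendant i b~i with toSum (i ≟ a) | toSum (i ≟ b)
  ... | inj₁ i≡a | _ = i≡a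
  ... | inj₂ _ | inj₁ refl = ⊥-elim (Adj⇒≢ {A = K} (kelmans-isMixedGraph mixed) {b} {b} b~i refl)
  ... | inj₂ i≢a | inj₂ i≢b with Adj-to-b i≢a i≢b (Adj-sym {A = K} {i = b} {j = i} b~i)
  ...   | i~a , i~b = ⊥-elim (acyclic (cycle₃ {A = T} mixed a~b (Adj-sym {A = T} i~b) i~a))

  K-isMixedTree : IsMixedTree K
  K-isMixedTree = KelmansTree.kelmans-isMixedTree tree a≢b a b-pendant
    (closes-cycle-adjacent {T = T} (inj₁ refl) (inj₂ refl) a≢b (Adj-sym {A = T} a~b))
    (closes-cycle-adjacent {T = T} (inj₂ refl) (inj₁ refl) (a≢b ∘ sym) a~b)
    (trans adj-a-b a~b ◅ ε)

module DistanceTwoMove {n} {T : Mat n} (tree : IsMixedTree T) {a b x : Fin n} (a≢b : a ≢ b) (¬a~b : ¬ Adj T a b)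
                       (a~x : Adj T a x) (x~b : Adj T x b) (shape : MiddleShape T a b x) where

  private
    mixed : IsMixedGraph T
    mixed = proj₁ tree
    acyclic : ¬ HasCycle T
    acyclic = proj₂ (proj₂ tree)
    a≢x : a ≢ x
    a≢x = Adj⇒≢ {A = T} mixed a~x
    x≢b : x ≢ b
    x≢b = Adj⇒≢ {A = T} mixed x~b

  open Kelmans a b T a≢b public

  b-pendant : ∀ i → Adj K b i → i ≡ x
  b-pendant i b~i with toSum (i ≟ x) | toSum (i ≟ a) | toSum (i ≟ b)
  ... | inj₁ i≡x | _ | _ = i≡x
  ... | inj₂ _ | inj₁ refl | _ = ⊥-elim (¬a~b (trans (sym adj-a-b) (Adj-sym {A = K} {i = b} {j = a} b~i)))
  ... | inj₂ _ | inj₂ _ | inj₁ refl = ⊥-elim (Adj⇒≢ {A = K} (kelmans-isMixedGraph mixed) {b} {b} b~i refl)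
  ... | inj₂ i≢x | inj₂ i≢a | inj₂ i≢b with Adj-to-b i≢a i≢b (Adj-sym {A = K} {i = b} {j = i} b~i)
  ...   | i~a , i~b = ⊥-elim (acyclic (cycle₄ {A = T} mixed (Adj-sym {A = T} i~a) i~b (Adj-sym {A = T} x~b)
                                                  (Adj-sym {A = T} a~x) a≢b i≢x))

  K-a~x : Adj K a x
  K-a~x = Adj-sym {A = K} {i = x} {j = a}
    (trans (adj-to-a (a≢x ∘ sym) x≢b) (cong (_∨ adjB T x b) (Adj-sym {A = T} a~x)))

  K-x~b : Adj K x b
  K-x~b = trans (cong₂ _∨_ (kelmans-to-b (a≢x ∘ sym) x≢b) (kelmans-from-b (a≢x ∘ sym) x≢b)) (by-shape shape)
    where
    by-shape : MiddleShape T a b x → ((T x a ∧ T x b) ∨ (T a x ∧ T b x)) ≡ true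
    by-shape (inj₁ (Tax , Txa)) rewrite Tax | Txa = x~b
    by-shape (inj₂ (inj₁ (Txb , Tbx)))
      rewrite Txb | Tbx | ∧-identityʳ (T x a) | ∧-identityʳ (T a x) = Adj-sym {A = T} a~x
    by-shape (inj₂ (inj₂ (inj₁ ((Tax , _) , (Tbx , _))))) rewrite Tax | Tbx = ∨-zeroʳ (T x a ∧ T x b)
    by-shape (inj₂ (inj₂ (inj₂ ((Txa , _) , (Txb , _))))) rewrite Txa | Txb = refl

  K-isMixedTree : IsMixedTree K
  K-isMixedTree = KelmansTree.kelmans-isMixedTree tree a≢b x b-pendant
    (closes-cycle-via {T = T} (inj₁ refl) (inj₂ refl) a≢b a~x x~b a≢x (x≢b ∘ sym))
    (closes-cycle-via {T = T} (inj₂ refl) (inj₁ refl) (a≢b ∘ sym) (Adj-sym {A = T} x~b) (Adj-sym {A = T} a~x)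
                      (x≢b ∘ sym) a≢x)
    (_◅_ {j = x} K-a~x (_◅_ {j = b} K-x~b ε))

isOne : ℕ → ℕ
isOne 1 = 1
isOne _ = 0

leafCount : ∀ {n} → Mat n → ℕ
leafCount A = Σ[ (λ i → isOne (deg A i)) ]

isOne-≥2 : ∀ {k} → 2 ≤ k → isOne k ≡ 0
isOne-≥2 {suc (suc k)} _ = refl
isOne-≥2 {suc zero} (s≤s ())

deg-cong : ∀ {n} {A B : Mat n} → (∀ i j → adjB A i j ≡ adjB B i j) → ∀ i → deg A i ≡ deg B i
deg-cong A≗B i = Σ-cong (λ j → cong b2n (A≗B i j))

leafCount-cong : ∀ {n} {A B : Mat n} → (∀ i j → adjB A i j ≡ adjB B i j) → leafCount A ≡ leafCount B
leafCount-cong {A = A} {B} A≗B = Σ-cong (λ i → cong isOne (deg-cong {A = A} {B = B} A≗B i))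

leafCount-Iso : ∀ {n} {A B : Mat n} → Iso A B → leafCount A ≡ leafCount B
leafCount-Iso {A = A} {B} (σ , A≅B) = trans (Σ-cong deg≡) (Σ-permute σ (λ i → isOne (deg B i)))
  where
  deg≡ : ∀ i → isOne (deg A i) ≡ isOne (deg B (Inverse.to σ i))
  deg≡ i = cong isOne (trans (Σ-cong (λ j → cong b2n (cong₂ _∨_ (A≅B i j) (A≅B j i))))
                             (Σ-permute σ (λ j → b2n (adjB B (Inverse.to σ i) j))))

true⇔⇒≡ : ∀ {x y} → (x ≡ true → y ≡ true) → (y ≡ true → x ≡ true) → x ≡ y
true⇔⇒≡ {true} x⇒y _ = sym (x⇒y refl)
true⇔⇒≡ {false} {true} _ y⇒x = y⇒x refl
true⇔⇒≡ {false} {false} _ _ = refl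

module LeafGain {n} (T : Mat n) {a b : Fin n} (a≢b : a ≢ b) where

  open Kelmans a b T a≢b

  deg-outside : ∀ {v} → v ≢ a → v ≢ b → (Adj T v a → Adj T v b → Adj K v b) → deg K v ≡ deg T v
  deg-outside {v} v≢a v≢b keeps-b = Σ-change₂-≡ a≢b (λ j j≢a j≢b → cong b2n (adj-outside v≢a v≢b j≢a j≢b))
    (trans (cong₂ _+_ (cong b2n (adj-to-a v≢a v≢b)) (cong b2n K-v~b≡∧))
           (b2n-∨+∧ (adjB T v a) (adjB T v b)))
    where
    K-v~b≡∧ : adjB K v b ≡ (adjB T v a ∧ adjB T v b)
    K-v~b≡∧ = true⇔⇒≡ (λ v~b → let (v~a , v~b) = Adj-to-b v≢a v≢b v~b in cong₂ _∧_ v~a v~b)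
                      (λ v~a∧b → keeps-b (∧-true-left v~a∧b) (∧-true-right v~a∧b))
      where
      ∧-true-left : ∀ {x y} → (x ∧ y) ≡ true → x ≡ true
      ∧-true-left {true} _ = refl
      ∧-true-right : ∀ {x y} → (x ∧ y) ≡ true → y ≡ true
      ∧-true-right {true} e = e

  deg-a-≤ : deg T a ≤ deg K a
  deg-a-≤ = Σ-mono-≤ entry
    where
    entry : ∀ j → b2n (adjB T a j) ≤ b2n (adjB K a j)
    entry j with toSum (j ≟ a) | toSum (j ≟ b)
    ... | inj₁ refl | _ = ≤-reflexive (cong b2n (sym (cong₂ _∨_ (kelmans-inside {a} {a} (inj₁ refl) (inj₁ refl))
                                                              (kelmans-inside {a} {a} (inj₁ refl) (inj₁ refl)))))
    ... | inj₂ _ | inj₁ refl = ≤-reflexive (cong b2n (sym adj-a-b))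
    ... | inj₂ j≢a | inj₂ j≢b
      rewrite adjB-sym T a j | adjB-sym K a j | adj-to-a j≢a j≢b = b2n-mono-∨ (adjB T j a) (adjB T j b)

  leafCount-gain : (c : Fin n) → Adj K b c → (∀ j → Adj K b j → j ≡ c) →
                   (∀ {v} → v ≢ a → v ≢ b → Adj T v a → Adj T v b → Adj K v b) →
                   ∀ {a′ b′} → ¬ Leaf T a → Adj T a a′ → ¬ Leaf T b → Adj T b b′ →
                   leafCount K ≡ suc (leafCount T)
  leafCount-gain c b~c b-pendant keeps-b {a′} {b′} ¬leaf-a a~a′ ¬leaf-b b~b′ =
    +-cancelʳ-≡ 0 _ _ (begin
      leafCount K + 0                                        ≡⟨ cong (leafCount K +_) T-ab ⟨
      leafCount K + (isOne (deg T a) + isOne (deg T b))      ≡⟨ Σ-change₂ a≢b outside ⟩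
      leafCount T + (isOne (deg K a) + isOne (deg K b))      ≡⟨ cong (leafCount T +_) K-ab ⟩
      leafCount T + 1                                        ≡⟨ +-comm (leafCount T) 1 ⟩
      suc (leafCount T)                                      ≡⟨ +-identityʳ _ ⟨
      suc (leafCount T) + 0                                  ∎)
    where
    open ≡-Reasoning
    outside : ∀ v → v ≢ a → v ≢ b → isOne (deg K v) ≡ isOne (deg T v)
    outside v v≢a v≢b = cong isOne (deg-outside v≢a v≢b (keeps-b v≢a v≢b))
    2≤deg-a : 2 ≤ deg T a
    2≤deg-a = ¬Leaf⇒2≤deg {A = T} a~a′ ¬leaf-a
    T-ab : isOne (deg T a) + isOne (deg T b) ≡ 0
    T-ab = cong₂ _+_ (isOne-≥2 2≤deg-a) (isOne-≥2 (¬Leaf⇒2≤deg {A = T} b~b′ ¬leaf-b))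
    K-b-leaf : deg K b ≡ 1
    K-b-leaf = trans (Σ-concentrated c not-c) (b2n-true b~c)
      where
      not-c : ∀ j → j ≢ c → b2n (adjB K b j) ≡ 0
      not-c j j≢c with adjB K b j in b~j
      ... | true = ⊥-elim (j≢c (b-pendant j b~j))
      ... | false = refl
    K-ab : isOne (deg K a) + isOne (deg K b) ≡ 1
    K-ab = cong₂ _+_ (isOne-≥2 (≤-trans 2≤deg-a deg-a-≤)) (cong isOne K-b-leaf)

LeafRaising : ∀ {n} → Mat n → Set
LeafRaising {n} T = Σ (Mat n) λ B → IsMixedTree B × T ≼ B × size B ≡ size T × leafCount B ≡ suc (leafCount T)

maximal⇒¬LeafRaising : ∀ {n} {m} {T : Mat n} → size T ≡ m → IsMaximal m T → ¬ LeafRaising T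
maximal⇒¬LeafRaising {T = T} size≡m maximal (B , tree , T≼B , size-B , gain) =
  1+n≢n (sym (trans (leafCount-Iso {A = T} {B = B} (maximal B tree (trans size-B size≡m) T≼B)) gain))

LeafRaising-≼ : ∀ {n} {T B : Mat n} → T ≼ B → size B ≡ size T → leafCount B ≡ leafCount T →
                LeafRaising B → LeafRaising T
LeafRaising-≼ T≼B size-B count-B (C , tree , B≼C , size-C , gain) =
  C , tree , T≼B ◅◅ B≼C , trans size-C size-B , trans gain (cong suc count-B)

kelmans-≼ : ∀ {n} {T : Mat n} {a b} → IsMixedTree T → Admissible T a b → T ≼ kelmans a b T
kelmans-≼ {T = T} {a} {b} tree admissible = inj₂ (tree , a , b , admissible , Iso-refl (kelmans a b T)) ◅ ε

module _ {n} {T : Mat n} (tree : IsMixedTree T) where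

  private
    mixed : IsMixedGraph T
    mixed = proj₁ tree
    acyclic : ¬ HasCycle T
    acyclic = proj₂ (proj₂ tree)

  undirected-raise : ∀ {a b} → Undir T a b → ¬ Leaf T a → ¬ Leaf T b → LeafRaising T
  undirected-raise {a} {b} ab ¬leaf-a ¬leaf-b =
    K , K-isMixedTree , kelmans-≼ tree admissible , size-kelmans ,
    LeafGain.leafCount-gain T a≢b a (Adj-sym {A = K} {i = a} {j = b} (trans adj-a-b a~b)) b-pendant keeps-b
                            ¬leaf-a a~b ¬leaf-b (Adj-sym {A = T} a~b)
    where
    a~b : Adj T a b
    a~b = Undir⇒Adj {A = T} ab
    open AdjacentMove {T = T} tree a~b
    admissible : Admissible T a b
    admissible = a≢b , Undir⇒¬Arc {A = T} ab , Undir⇒¬Arc {A = T} (proj₂ ab , proj₁ ab) , inj₁ ab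
    keeps-b : ∀ {v} → v ≢ a → v ≢ b → Adj T v a → Adj T v b → Adj K v b
    keeps-b _ _ v~a v~b = ⊥-elim (acyclic (cycle₃ {A = T} mixed a~b (Adj-sym {A = T} v~b) v~a))

  arcPair-raise : ∀ {a b x} → a ≢ b → (Arc T a x × Arc T b x) ⊎ (Arc T x a × Arc T x b) →
                  ¬ Leaf T a → ¬ Leaf T b → LeafRaising T
  arcPair-raise {a} {b} {x} a≢b arcs ¬leaf-a ¬leaf-b =
    K , K-isMixedTree , kelmans-≼ tree admissible , size-kelmans ,
    LeafGain.leafCount-gain T a≢b x (Adj-sym {A = K} {i = x} {j = b} K-x~b) b-pendant keeps-b
                            ¬leaf-a a~x ¬leaf-b (Adj-sym {A = T} x~b)
    where
    a~x : Adj T a x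
    a~x = [ Arc⇒Adj {A = T} ∘ proj₁ , Adj-sym {A = T} ∘ Arc⇒Adj {A = T} ∘ proj₁ ]′ arcs
    x~b : Adj T x b
    x~b = [ Adj-sym {A = T} ∘ Arc⇒Adj {A = T} ∘ proj₂ , Arc⇒Adj {A = T} ∘ proj₂ ]′ arcs
    ¬a~b : ¬ Adj T a b
    ¬a~b a~b = acyclic (cycle₃ {A = T} mixed a~b (Adj-sym {A = T} x~b) (Adj-sym {A = T} a~x))
    admissible : Admissible T a b
    admissible = a≢b , ¬Adj⇒¬Arc {A = T} ¬a~b , ¬Adj⇒¬Arc {A = T} (¬a~b ∘ Adj-sym {A = T}) ,
                 inj₂ (¬a~b , x , a~x , x~b , inj₂ (inj₂ arcs))
    open DistanceTwoMove {T = T} tree a≢b ¬a~b a~x x~b (inj₂ (inj₂ arcs))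
    keeps-b : ∀ {v} → v ≢ a → v ≢ b → Adj T v a → Adj T v b → Adj K v b
    keeps-b {v} _ _ v~a v~b with toSum (v ≟ x)
    ... | inj₁ refl = K-x~b
    ... | inj₂ v≢x = ⊥-elim (acyclic (cycle₄ {A = T} mixed (Adj-sym {A = T} v~a) v~b (Adj-sym {A = T} x~b)
                                                 (Adj-sym {A = T} a~x) a≢b v≢x))

  leaves-around⇒star : ∀ u → (∀ w → Adj T u w → Leaf T w) → IsMixedStar T
  leaves-around⇒star u leaves = tree , λ i j → within-two (near i) (near j)
    where
    reach : ∀ {s k} → Star (Adj T) s k → s ≡ u ⊎ Adj T u s → k ≡ u ⊎ Adj T u k
    reach ε s-near = s-near
    reach (s~t ◅ t⇝k) (inj₁ refl) = reach t⇝k (inj₂ s~t)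
    reach {s} (s~t ◅ t⇝k) (inj₂ u~s) =
      reach t⇝k (inj₁ (sym (Leaf-neighbour-unique {A = T} (leaves s u~s) (Adj-sym {A = T} u~s) s~t)))
    near : ∀ k → k ≡ u ⊎ Adj T u k
    near k = reach (proj₁ (proj₂ tree) u k) (inj₁ refl)
    within-two : ∀ {i j} → i ≡ u ⊎ Adj T u i → j ≡ u ⊎ Adj T u j →
                 i ≡ j ⊎ Adj T i j ⊎ Σ (Fin n) λ x → Adj T i x × Adj T x j
    within-two (inj₁ refl) (inj₁ refl) = inj₁ refl
    within-two (inj₁ refl) (inj₂ u~j) = inj₂ (inj₁ u~j)
    within-two (inj₂ u~i) (inj₁ refl) = inj₂ (inj₁ (Adj-sym {A = T} u~i))
    within-two {i} {j} (inj₂ u~i) (inj₂ u~j) with i ≟ j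
    ... | yes i≡j = inj₁ i≡j
    ... | no _ = inj₂ (inj₂ (u , Adj-sym {A = T} u~i , u~j))

-- For a pendant undirected edge uv and another neighbour w of u, T_v^w keeps the underlying tree and
-- makes uw undirected.
module Reorient {n} {T : Mat n} (tree : IsMixedTree T) {u v w : Fin n} (uv : Undir T u v) (leaf-v : Leaf T v)
                (u~w : Adj T u w) (¬leaf-w : ¬ Leaf T w) where

  private
    acyclic : ¬ HasCycle T
    acyclic = proj₂ (proj₂ tree)
    u~v : Adj T u v
    u~v = Undir⇒Adj {A = T} uv
    w≢v : w ≢ v
    w≢v refl = ¬leaf-w leaf-v
    u≢w : u ≢ w
    u≢w = Adj⇒≢ {A = T} (proj₁ tree) u~w
    u≢v : u ≢ v
    u≢v = Adj⇒≢ {A = T} (proj₁ tree) u~v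
    only-u : ∀ {i} → Adj T i v → i ≡ u
    only-u i~v = sym (Leaf-neighbour-unique {A = T} leaf-v (Adj-sym {A = T} u~v) (Adj-sym {A = T} i~v))
    ¬w~v : ¬ Adj T w v
    ¬w~v w~v = u≢w (sym (only-u w~v))

  open Kelmans w v T w≢v public

  admissible : Admissible T w v
  admissible = w≢v , ¬Adj⇒¬Arc {A = T} ¬w~v , ¬Adj⇒¬Arc {A = T} (¬w~v ∘ Adj-sym {A = T}) ,
               inj₂ (¬w~v , u , Adj-sym {A = T} u~w , u~v , inj₂ (inj₁ uv))

  private
    ¬Adj-v : ∀ {i} → i ≢ u → adjB T i v ≡ false
    ¬Adj-v {i} i≢u with adjB T i v in i~v
    ... | true = ⊥-elim (i≢u (only-u i~v))
    ... | false = refl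

    same-adj-outside : ∀ {i} → i ≢ w → i ≢ v → ∀ j → adjB K i j ≡ adjB T i j
    same-adj-outside {i} i≢w i≢v j with toSum (j ≟ w) | toSum (j ≟ v) | toSum (i ≟ u)
    ... | inj₂ j≢w | inj₂ j≢v | _ = adj-outside i≢w i≢v j≢w j≢v
    ... | inj₁ refl | _ | inj₁ refl rewrite adj-to-a i≢w i≢v | u~w = refl
    ... | inj₁ refl | _ | inj₂ i≢u = trans (adj-to-a i≢w i≢v) (trans (cong (adjB T i w ∨_) (¬Adj-v i≢u)) (∨-identityʳ _))
    ... | inj₂ _ | inj₁ refl | inj₁ refl =
      trans (cong₂ _∨_ (kelmans-to-b i≢w i≢v) (kelmans-from-b i≢w i≢v))
            (trans (cong₂ _∨_ (cong (T u w ∧_) (proj₁ uv)) (cong (T w u ∧_) (proj₂ uv)))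
                   (trans (cong₂ _∨_ (∧-identityʳ (T u w)) (∧-identityʳ (T w u))) (trans u~w (sym u~v))))
    ... | inj₂ _ | inj₁ refl | inj₂ i≢u = trans K-false (sym (¬Adj-v i≢u))
      where
      K-false : adjB K i v ≡ false
      K-false with adjB K i v in i~v
      ... | true = ⊥-elim (i≢u (only-u (proj₂ (Adj-to-b i≢w i≢v i~v))))
      ... | false = refl

    same-adj-inside : ∀ {i} → i ≡ w ⊎ i ≡ v → ∀ j → adjB K i j ≡ adjB T i j
    same-adj-inside {i} i∈wv j with toSum (j ≟ w) | toSum (j ≟ v)
    ... | inj₁ j≡w | _ = cong₂ _∨_ (kelmans-inside i∈wv (inj₁ j≡w)) (kelmans-inside (inj₁ j≡w) i∈wv)
    ... | inj₂ _ | inj₁ j≡v = cong₂ _∨_ (kelmans-inside i∈wv (inj₂ j≡v)) (kelmans-inside (inj₂ j≡v) i∈wv)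
    ... | inj₂ j≢w | inj₂ j≢v = trans (adjB-sym K i j) (trans (same-adj-outside j≢w j≢v i) (adjB-sym T j i))

  same-adj : ∀ i j → adjB K i j ≡ adjB T i j
  same-adj i j with toSum (i ≟ w) | toSum (i ≟ v)
  ... | inj₁ i≡w | _ = same-adj-inside (inj₁ i≡w) j
  ... | inj₂ _ | inj₁ i≡v = same-adj-inside (inj₂ i≡v) j
  ... | inj₂ i≢w | inj₂ i≢v = same-adj-outside i≢w i≢v j

  K-isMixedTree : IsMixedTree K
  K-isMixedTree =
    kelmans-isMixedGraph (proj₁ tree) ,
    (λ i j → Star-map (λ {k} {l} → trans (same-adj k l)) (proj₁ (proj₂ tree) i j)) ,
    λ { (c , cs , len , unique , cycle) →
        acyclic (c , cs , len , unique , Linked.map (λ {k} {l} → trans (sym (same-adj k l))) cycle) }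

  K-uw : Undir K u w
  K-uw = trans (kelmans-to-a (u≢w) u≢v) (trans (cong (T u w ∨_) (proj₁ uv)) (∨-zeroʳ _)) ,
         trans (kelmans-from-a u≢w u≢v) (trans (cong (T w u ∨_) (proj₂ uv)) (∨-zeroʳ _))

module _ {n} {T : Mat n} (tree : IsMixedTree T) (¬star : ¬ IsMixedStar T) where

  pendant-undirected-raise : ∀ {u v} → Undir T u v → Leaf T v → LeafRaising T
  pendant-undirected-raise {u} {v} uv leaf-v with any? (λ w → Adj? T u w ×-dec ¬? (Leaf? T w))
  ... | no leaves-around = ⊥-elim (¬star (leaves-around⇒star {T = T} tree u λ w u~w →
                             decidable-stable (Leaf? T w) λ ¬leaf-w → leaves-around (w , u~w , ¬leaf-w)))
  ... | yes (w , u~w , ¬leaf-w) with Undir? T u w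
  ...   | yes uw = undirected-raise {T = T} tree uw ¬leaf-u ¬leaf-w
    where
    ¬leaf-u : ¬ Leaf T u
    ¬leaf-u leaf-u = ¬leaf-w (subst (Leaf T) (Leaf-neighbour-unique {A = T} leaf-u (Undir⇒Adj {A = T} uv) u~w) leaf-v)
  ...   | no _ =
    LeafRaising-≼ (kelmans-≼ tree admissible) size-kelmans (leafCount-cong {A = K} {B = T} same-adj)
      (undirected-raise {T = K} K-isMixedTree {u} {w} K-uw (¬leaf-u ∘ K⇒T) (¬leaf-w ∘ K⇒T))
    where
    open Reorient {T = T} tree uv leaf-v u~w ¬leaf-w
    K⇒T : ∀ {i} → Leaf K i → Leaf T i
    K⇒T {i} = trans (sym (deg-cong {A = K} {B = T} same-adj i))
    ¬leaf-u : ¬ Leaf T u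
    ¬leaf-u leaf-u = ¬leaf-w (subst (Leaf T) (Leaf-neighbour-unique {A = T} leaf-u (Undir⇒Adj {A = T} uv) u~w) leaf-v)

  nonstar-undirected-raise : ∀ {u v} → Undir T u v → LeafRaising T
  nonstar-undirected-raise {u} {v} uv with Leaf? T v | Leaf? T u
  ... | yes leaf-v | _ = pendant-undirected-raise uv leaf-v
  ... | no _ | yes leaf-u = pendant-undirected-raise (proj₂ uv , proj₁ uv) leaf-u
  ... | no ¬leaf-v | no ¬leaf-u = undirected-raise {T = T} tree uv ¬leaf-u ¬leaf-v

diameter≤2? : ∀ {n} (T : Mat n) → Dec ((i j : Fin n) → i ≡ j ⊎ Adj T i j ⊎ Σ (Fin n) λ x → Adj T i x × Adj T x j)
diameter≤2? T = all? λ i → all? λ j → (i ≟ j) ⊎-dec (Adj? T i j ⊎-dec any? λ x → Adj? T i x ×-dec Adj? T x j)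

module _ {n} {m : ℕ} {T : Mat n} (tree : IsMixedTree T) where

  maximal⇒star-or-arcTree : size T ≡ m → IsMaximal m T → IsMixedStar T ⊎ (NoUndirected T × ArcPairCond T)
  maximal⇒star-or-arcTree size≡m maximal with diameter≤2? T
  ... | yes diameter≤2 = inj₁ (tree , diameter≤2)
  ... | no ¬diameter≤2 = inj₂ (no-undirected , leaf-condition)
    where
    ¬raising : ¬ LeafRaising T
    ¬raising = maximal⇒¬LeafRaising {T = T} size≡m maximal
    ¬star : ¬ IsMixedStar T
    ¬star = ¬diameter≤2 ∘ proj₂
    no-undirected : NoUndirected T
    no-undirected _ _ uv = ¬raising (nonstar-undirected-raise {T = T} tree ¬star uv)
    leaf-condition : ArcPairCond T
    leaf-condition a b x a≢b _ _ arcs with Leaf? T a | Leaf? T b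
    ... | yes leaf-a | _ = inj₁ leaf-a
    ... | no _ | yes leaf-b = inj₂ leaf-b
    ... | no ¬leaf-a | no ¬leaf-b = ⊥-elim (¬raising (arcPair-raise {T = T} tree a≢b arcs ¬leaf-a ¬leaf-b))

  star-or-arcTree⇒maximal : IsMixedStar T ⊎ (NoUndirected T × ArcPairCond T) → IsMaximal m T
  star-or-arcTree⇒maximal (inj₁ star) = dominated⇒maximal tree (star-domination star) m
  star-or-arcTree⇒maximal (inj₂ (no-undirected , leaf-condition)) =
    dominated⇒maximal tree (arcTree-domination tree no-undirected leaf-condition) m

proposition4p2 : (n m : ℕ) (T : Mat n) → IsMixedTree T → size T ≡ m →
    (IsMaximal m T ⇔ (IsMixedStar T ⊎ (NoUndirected T × ArcPairCond T)))
proposition4p2 n m T tree size≡m =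
  mk⇔ (maximal⇒star-or-arcTree tree size≡m) (star-or-arcTree⇒maximal tree)
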